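{- For all integers $d\ge 1$ and $n\ge 0$ there is a bijection between the set of (structurally different) guillotine partitions of a $2^{d-1}$-dimensional box by $n$ cuts and the set of separable $d$-permutations of $[n+1]$.
   Context: Guillotine partitions: Let $B$ be an axis-parallel box in $\mathbb{R}^q$. A partition of $B$ is a set $S$ of $k>0$ interior-disjoint axis-parallel boxes whose union is $B$. $S$ is a guillotine partition if $k=1$, or there are a hyperplane $h$ (orthogonal to some axis $x_i$) and disjoint nonempty $S^-,S^+\subset S$ such that $h$ splits $B$ into interior-disjoint boxes $B^-$ (below $h$ w.r.t. $x_i$) and $B^+$ (above $h$), $S^-$ is a guillotine partition of $B^-$ and $S^+$ is a guillotine partition of $B^+$. Such hyperplanes for $B$ are all orthogonal to the same axis. Structure is recorded by a vertex-colored binary tree: the trivial partition gives the empty tree; otherwise take the highest such hyperplane $h$ (orthogonal to $x_i$), color the root $i$, and let the left and right subtrees be the trees of the induced partitions of $B^-$ and $B^+$. Two guillotine partitions are structurally identical iff they have the same tree, and "guillotine partitions" means structural equivalence classes; the number of cuts is the number of tree vertices. Equivalently, guillotine partitions of a $q$-box by $n$ cuts correspond to binary trees with $n$ vertices colored by $\{1,\dots,q\}$ in which no vertex has a right child of the same color. A $d$-permutation of $[n]$ is a $d\times n$ matrix $P$ each row of which is a permutation of $[n]$, the first row being $1\,2\cdots n$. It is separable if $n=1$, or $n>1$ and there is $1\le \ell<n$ such that for each row $i$ either $P_{ij_1}<P_{ij_2}$ for all $j_1\le\ell<j_2$ or $P_{ij_1}>P_{ij_2}$ for all $j_1\le\ell<j_2$,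 and the $d$-permutations formed by the first $\ell$ columns and by the last $n-\ell$ columns (each row relabeled order-preservingly) are separable. -}

module Defs where

open import Data.Bool using (Bool; true; false; _∧_; _∨_; not; if_then_else_)
open import Data.Nat using (ℕ; zero; suc; _+_; _<ᵇ_; _≡ᵇ_)
open import Data.Fin using (Fin; toℕ)
open import Data.Fin.Properties using (_≟_)
open import Data.List using (List; []; _∷_; length; map; take; drop; upTo; filter)
open import Data.Bool.ListAction using (all; any)
open import Data.Vec.Properties using (≡-dec)
open import Data.Vec using (Vec; []; _∷_; toList; allFin)
open import Data.Product using (Σ; _×_)
open import Relation.Nullary.Decidable using (⌊_⌋)
open import Relation.Binary.PropositionalEquality using (_≡_)

-- Guillotine partitions of a q-box, encoded (as in the paper) by binary
-- trees whose vertices are coloured by the axes {1..q} (here Fin q),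
-- such that no vertex has a right child of the same colour.

data BTree (q : ℕ) : Set where
  leaf : BTree q
  node : Fin q → BTree q → BTree q → BTree q

-- number of vertices = number of cuts
size : ∀ {q} → BTree q → ℕ
size leaf = 0
size (node _ l r) = suc (size l + size r)

rightOk : ∀ {q} → Fin q → BTree q → Bool
rightOk c leaf = true
rightOk c (node c' _ _) = not ⌊ c ≟ c' ⌋

validTree : ∀ {q} → BTree q → Bool
validTree leaf = true
validTree (node c l r) = rightOk c r ∧ validTree l ∧ validTree r

Guillotine : ℕ → ℕ → Set
Guillotine q n = Σ (BTree q) λ t → (size t ≡ n) × (validTree t ≡ true)

-- d-permutations. A d-permutation of [m] is a d × m matrix, each row a
-- permutation of [m] (entries 0..m-1 here, i.e. Fin m), first row the
-- identity.

distinct : List ℕ → Bool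
distinct [] = true
distinct (x ∷ xs) = all (λ y → not (x ≡ᵇ y)) xs ∧ distinct xs

-- each row of a Vec (Fin m) m is a permutation iff its entries are distinct
isDPerm : ∀ {d m} → Vec (Vec (Fin m) m) d → Bool
isDPerm [] = true
isDPerm {m = m} (r₀ ∷ rs) =
  ⌊ ≡-dec _≟_ r₀ (allFin m) ⌋ ∧ distinct (map toℕ (toList r₀))
    ∧ all (λ r → distinct (map toℕ r)) (map toList (toList rs))

relabel : List ℕ → List ℕ
relabel xs = map (λ x → length (filter (λ y → y Data.Nat.<? x) xs)) xs
  where import Data.Nat

splitsAt : ℕ → List ℕ → Bool
splitsAt ℓ row =
  all (λ a → all (λ b → a <ᵇ b) (drop ℓ row)) (take ℓ row)
  ∨ all (λ a → all (λ b → b <ᵇ a) (drop ℓ row)) (take ℓ row)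

-- separability of a matrix with m columns given as a list of rows;
-- the first argument is fuel (recursion on the number of columns,
-- which strictly decreases; fuel = m suffices).
sepAux : ℕ → ℕ → List (List ℕ) → Bool
sepAux zero m rows = false
sepAux (suc f) m rows =
  (m ≡ᵇ 1) ∨
  ((1 <ᵇ m) ∧
   any (λ ℓ → (0 <ᵇ ℓ) ∧
              all (splitsAt ℓ) rows ∧
              sepAux f ℓ (map (λ r → relabel (take ℓ r)) rows) ∧
              sepAux f (m Data.Nat.∸ ℓ) (map (λ r → relabel (drop ℓ r)) rows))
       (upTo m))
  where import Data.Nat

separable : ∀ {d m} → Vec (Vec (Fin m) m) d → Bool
separable {m = m} P = sepAux m m (map (λ r → map toℕ (toList r)) (toList P))

SeparableDPerm : ℕ → ℕ → Set
SeparableDPerm d m =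
  Σ (Vec (Vec (Fin m) m) d) λ P → (isDPerm P ≡ true) × (separable P ≡ true)

-- Cutting a box at a hyperplane orthogonal to axis c corresponds to gluing the d-permutations
-- of the two halves: row by row, either as a direct sum (left block below right block) or as a
-- skew sum. The first row is always a direct sum, so it stays the identity, and the directions of
-- the other d - 1 rows are the bits of c, which is why there are 2^(d-1) axes. Conversely a
-- separable d-permutation is cut at its last split position, the highest hyperplane, whose
-- directions give back the colour. The two maps are inverse because the rows of a tree split only
-- at the root position and inside the right subtree, and a split inside the right subtree would
-- mean that the right child had the colour of the root; dually, if the right part of the last split
-- had a last split in the same directions, the two would combine into a later split of the whole.

module Submission where

open import Defs
open import Data.Bool using (Bool; true; false; _∧_; _∨_; not; if_then_else_)
import Data.Bool.Properties as Boolₚ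
open Boolₚ using (T-≡)
open import Axiom.UniquenessOfIdentityProofs using (module Decidable⇒UIP)
open import Data.Bool.ListAction using (all; any)
open import Data.Nat
open import Data.Nat.Properties
open import Data.List using (List; []; _∷_; [_]; length; map; take; drop; upTo; applyUpTo; filter; replicate; _++_)
open import Data.List.Properties
  using (map-++; length-map; length-++; take-map; drop-map; map-∘; map-cong; map-cong-local; map-id-local;
         take++drop≡id; length-take; length-drop; drop-drop; take-drop; take-take; length-replicate; ∷-injective;
         filter-++; filter-all; filter-none; take-[]; length-upTo; map-applyUpTo; ∷-injectiveʳ)
open import Data.List.Relation.Unary.All as All using (All; []; _∷_)
import Data.List.Relation.Unary.All.Properties as Allₚ
import Data.List.Relation.Unary.Any.Properties as Anyₚ
open import Data.List.Relation.Unary.Any using (here; there)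
import Data.List.Relation.Unary.AllPairs as AllPairs
open AllPairs using ([]; _∷_)
import Data.List.Relation.Unary.AllPairs.Properties as AllPairsₚ
open import Data.List.Relation.Unary.Unique.Propositional using (Unique)
import Data.List.Relation.Unary.Unique.Propositional.Properties as Uniqueₚ
open import Data.List.Membership.Propositional using (_∈_)
open import Data.Fin as Fin using (Fin; toℕ; fromℕ<; finToFun; funToFin; combine)
open import Data.Fin.Properties
  using (2↔Bool; toℕ-injective; toℕ-fromℕ<; toℕ<n; funToFin-finToFin; finToFun-funToFin) renaming (_≟_ to _≟ᶠ_)
open import Data.Vec as Vec using (Vec; []; _∷_; toList; tabulate; allFin)
open import Data.Vec.Properties using (length-toList; ≡-dec; lookup∘tabulate; tabulate-cong; tabulate∘lookup)
open import Function.Bundles using (Inverse; _⤖_; mk↔ₛ′)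
open import Function.Properties.Inverse using (↔⇒⤖)
open import Data.Product using (Σ; ∃; _×_; _,_; proj₁; proj₂)
open import Data.Sum using (_⊎_; inj₁; inj₂; [_,_]′)
open import Data.Maybe using (Maybe; just; nothing)
open import Data.Empty using (⊥; ⊥-elim)
open import Data.Unit using (⊤; tt)
open import Function using (_∘_; id; Equivalence)
open import Relation.Nullary using (yes; no; does; contradiction)
open import Relation.Nullary.Decidable using (⌊_⌋; toWitness; fromWitness)
open import Relation.Unary using (Decidable)
open import Relation.Unary.Properties using (∁?)
open import Relation.Binary.PropositionalEquality hiding ([_])

∧-intro : ∀ {a b} → a ≡ true → b ≡ true → a ∧ b ≡ true
∧-intro refl refl = refl

∧-elimˡ : ∀ {a b} → a ∧ b ≡ true → a ≡ true
∧-elimˡ {true} _ = refl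

∧-elimʳ : ∀ {a b} → a ∧ b ≡ true → b ≡ true
∧-elimʳ {true} b = b

∨-introˡ : ∀ {a b} → a ≡ true → a ∨ b ≡ true
∨-introˡ refl = refl

∨-introʳ : ∀ {a b} → b ≡ true → a ∨ b ≡ true
∨-introʳ {true} _ = refl
∨-introʳ {false} b = b

∨-elim : ∀ {a b} → a ∨ b ≡ true → a ≡ true ⊎ b ≡ true
∨-elim {true} _ = inj₁ refl
∨-elim {false} b = inj₂ b

true≢false : true ≢ false
true≢false ()

module _ {A : Set} {p : A → Bool} where

  all-true⁻ : ∀ xs → all p xs ≡ true → All (λ x → p x ≡ true) xs
  all-true⁻ [] _ = []
  all-true⁻ (x ∷ xs) e = ∧-elimˡ e ∷ all-true⁻ xs (∧-elimʳ e)

  all-true⁺ : ∀ {xs} → All (λ x → p x ≡ true) xs → all p xs ≡ true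
  all-true⁺ [] = refl
  all-true⁺ (px ∷ pxs) = ∧-intro px (all-true⁺ pxs)

  all-cong-local : ∀ {Q : A → Set} {p′ : A → Bool} {xs} → All Q xs →
                   (∀ {x} → Q x → p x ≡ p′ x) → all p xs ≡ all p′ xs
  all-cong-local [] _ = refl
  all-cong-local (qx ∷ qxs) p≡p′ = cong₂ _∧_ (p≡p′ qx) (all-cong-local qxs p≡p′)

  all-map : ∀ {B : Set} (g : B → A) xs → all p (map g xs) ≡ all (p ∘ g) xs
  all-map g [] = refl
  all-map g (x ∷ xs) = cong (p (g x) ∧_) (all-map g xs)

map-≡⇒All : ∀ {A B : Set} {f g : A → B} xs → map f xs ≡ map g xs → All (λ x → f x ≡ g x) xs
map-≡⇒All [] _ = []
map-≡⇒All (x ∷ xs) e = proj₁ (∷-injective e) ∷ map-≡⇒All xs (proj₂ (∷-injective e))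

any-upTo⁻ : ∀ (p : ℕ → Bool) n → any p (upTo n) ≡ true → ∃ λ j → j < n × p j ≡ true
any-upTo⁻ p n e with j , j<n , pj ← Anyₚ.applyUpTo⁻ id (Anyₚ.any⁻ p (upTo n) (Equivalence.from T-≡ e))
  = j , j<n , Equivalence.to T-≡ pj

any-upTo⁺ : ∀ (p : ℕ → Bool) {n j} → j < n → p j ≡ true → any p (upTo n) ≡ true
any-upTo⁺ p j<n pj = Equivalence.to T-≡ (Anyₚ.any⁺ p (Anyₚ.applyUpTo⁺ id (Equivalence.from T-≡ pj) j<n))

<ᵇ-true⇒< : ∀ {m n} → (m <ᵇ n) ≡ true → m < n
<ᵇ-true⇒< {m} {n} e = <ᵇ⇒< m n (Equivalence.from T-≡ e)

<⇒<ᵇ-true : ∀ {m n} → m < n → (m <ᵇ n) ≡ true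
<⇒<ᵇ-true m<n = Equivalence.to T-≡ (<⇒<ᵇ m<n)

<ᵇ-false⇒≥ : ∀ {m n} → (m <ᵇ n) ≡ false → n ≤ m
<ᵇ-false⇒≥ e = ≮⇒≥ λ m<n → true≢false (trans (sym (<⇒<ᵇ-true m<n)) e)

≥⇒<ᵇ-false : ∀ {m n} → n ≤ m → (m <ᵇ n) ≡ false
≥⇒<ᵇ-false {m} {n} n≤m with m <ᵇ n in e
... | true = contradiction n≤m (<⇒≱ (<ᵇ-true⇒< e))
... | false = refl

+-<ᵇ-cancelˡ : ∀ a m n → (a + m <ᵇ a + n) ≡ (m <ᵇ n)
+-<ᵇ-cancelˡ zero m n = refl
+-<ᵇ-cancelˡ (suc a) m n = +-<ᵇ-cancelˡ a m n

-- Ranks and relabelling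

-- Chosen so that relabel xs ≡ map (λ x → rank x xs) xs holds definitionally.
rank : ℕ → List ℕ → ℕ
rank x xs = length (filter (_<? x) xs)

rank-++ : ∀ x xs ys → rank x (xs ++ ys) ≡ rank x xs + rank x ys
rank-++ x xs ys = trans (cong length (filter-++ (_<? x) xs ys)) (length-++ (filter (_<? x) xs))

rank-all-below : ∀ {x} xs → All (_< x) xs → rank x xs ≡ length xs
rank-all-below xs p = cong length (filter-all (_<? _) p)

rank-all-above : ∀ {x} xs → All (x ≤_) xs → rank x xs ≡ 0
rank-all-above xs p = cong length (filter-none (_<? _) (All.map ≤⇒≯ p))

rank-mono : ∀ {z′ z} ws → z′ ≤ z → rank z′ ws ≤ rank z ws
rank-mono [] _ = z≤n
rank-mono {z′} {z} (w ∷ ws) z′≤z with w <ᵇ z′ in e₁ | w <ᵇ z in e₂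
... | true | true = s≤s (rank-mono ws z′≤z)
... | true | false = contradiction (<ᵇ-false⇒≥ e₂) (<⇒≱ (<-≤-trans (<ᵇ-true⇒< e₁) z′≤z))
... | false | true = m≤n⇒m≤1+n (rank-mono ws z′≤z)
... | false | false = rank-mono ws z′≤z

rank-strict : ∀ {z′ z} ws → z′ < z → z′ ∈ ws → rank z′ ws < rank z ws
rank-strict {z′} {z} (w ∷ ws) z′<z (here refl) with w <ᵇ z′ in e₁ | w <ᵇ z in e₂
... | true | _ = contradiction (<ᵇ-true⇒< {w} e₁) (<-irrefl refl)
... | false | true = s≤s (rank-mono ws (<⇒≤ z′<z))
... | false | false = contradiction z′<z (≤⇒≯ (<ᵇ-false⇒≥ e₂))
rank-strict {z′} {z} (w ∷ ws) z′<z (there z′∈) with w <ᵇ z′ in e₁ | w <ᵇ z in e₂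
... | true | true = s≤s (rank-strict ws z′<z z′∈)
... | true | false = contradiction (<-trans (<ᵇ-true⇒< e₁) z′<z) (≤⇒≯ (<ᵇ-false⇒≥ e₂))
... | false | true = m≤n⇒m≤1+n (rank-strict ws z′<z z′∈)
... | false | false = rank-strict ws z′<z z′∈

OrderPreservingOn : (ℕ → Set) → (ℕ → ℕ) → Set
OrderPreservingOn Q g = ∀ {z z′} → Q z → Q z′ → (g z′ <ᵇ g z) ≡ (z′ <ᵇ z)

rank-orderPreserving : ∀ xs → OrderPreservingOn (_∈ xs) (λ x → rank x xs)
rank-orderPreserving xs {z} {z′} _ z′∈ with z′ <ᵇ z in e
... | true = <⇒<ᵇ-true (rank-strict xs (<ᵇ-true⇒< e) z′∈)
... | false = ≥⇒<ᵇ-false (rank-mono xs (<ᵇ-false⇒≥ e))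

+-orderPreserving : ∀ a → OrderPreservingOn (λ _ → ⊤) (a +_)
+-orderPreserving a {z} {z′} _ _ = +-<ᵇ-cancelˡ a z′ z

∈-self : ∀ (xs : List ℕ) → All (_∈ xs) xs
∈-self [] = []
∈-self (x ∷ xs) = here refl ∷ All.map there (∈-self xs)

module _ {Q : ℕ → Set} {g : ℕ → ℕ} (g-ord : OrderPreservingOn Q g) where

  rank-map : ∀ {z} ws → Q z → All Q ws → rank (g z) (map g ws) ≡ rank z ws
  rank-map [] _ [] = refl
  rank-map {z} (w ∷ ws) qz (qw ∷ qws) rewrite g-ord qz qw with w <ᵇ z
  ... | true = cong suc (rank-map ws qz qws)
  ... | false = rank-map ws qz qws

  relabel-map : ∀ zs → All Q zs → relabel (map g zs) ≡ relabel zs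
  relabel-map zs qzs = trans (sym (map-∘ zs)) (map-cong-local (All.map (λ qz → rank-map zs qz qzs) qzs))

relabel-idem : ∀ xs → relabel (relabel xs) ≡ relabel xs
relabel-idem xs = relabel-map (rank-orderPreserving xs) xs (∈-self xs)

relabel-take : ∀ n xs → relabel (take n (relabel xs)) ≡ relabel (take n xs)
relabel-take n xs rewrite take-map {f = λ x → rank x xs} n xs =
  relabel-map (rank-orderPreserving xs) (take n xs) (Allₚ.take⁺ n (∈-self xs))

relabel-drop : ∀ n xs → relabel (drop n (relabel xs)) ≡ relabel (drop n xs)
relabel-drop n xs rewrite drop-map {f = λ x → rank x xs} n xs =
  relabel-map (rank-orderPreserving xs) (drop n xs) (Allₚ.drop⁺ n (∈-self xs))

relabel-+ : ∀ a xs → relabel (map (a +_) xs) ≡ relabel xs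
relabel-+ a xs = relabel-map (+-orderPreserving a) xs (All.universal (λ _ → tt) xs)

relabel-++-ascending : ∀ xs ys → All (λ x → All (x <_) ys) xs →
                       relabel (xs ++ ys) ≡ relabel xs ++ map (length xs +_) (relabel ys)
relabel-++-ascending xs ys xs<ys = begin
  relabel (xs ++ ys)
    ≡⟨ map-++ (λ z → rank z (xs ++ ys)) xs ys ⟩
  map (λ z → rank z (xs ++ ys)) xs ++ map (λ z → rank z (xs ++ ys)) ys
    ≡⟨ cong₂ _++_ (map-cong-local (All.map rank-left xs<ys))
                  (trans (map-cong-local (All.map rank-right (Allₚ.All-swap xs<ys))) (map-∘ ys)) ⟩
  relabel xs ++ map (length xs +_) (relabel ys) ∎
  where
  open ≡-Reasoning
  rank-left : ∀ {x} → All (x <_) ys → rank x (xs ++ ys) ≡ rank x xs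
  rank-left x<ys = begin
    rank _ (xs ++ ys)       ≡⟨ rank-++ _ xs ys ⟩
    rank _ xs + rank _ ys   ≡⟨ cong (_ +_) (rank-all-above ys (All.map <⇒≤ x<ys)) ⟩
    rank _ xs + 0           ≡⟨ +-identityʳ _ ⟩
    rank _ xs               ∎
  rank-right : ∀ {y} → All (_< y) xs → rank y (xs ++ ys) ≡ length xs + rank y ys
  rank-right xs<y = trans (rank-++ _ xs ys) (cong (_+ _) (rank-all-below xs xs<y))

relabel-++-descending : ∀ xs ys → All (λ x → All (_< x) ys) xs →
                        relabel (xs ++ ys) ≡ map (length ys +_) (relabel xs) ++ relabel ys
relabel-++-descending xs ys ys<xs = begin
  relabel (xs ++ ys)
    ≡⟨ map-++ (λ z → rank z (xs ++ ys)) xs ys ⟩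
  map (λ z → rank z (xs ++ ys)) xs ++ map (λ z → rank z (xs ++ ys)) ys
    ≡⟨ cong₂ _++_ (trans (map-cong-local (All.map rank-left ys<xs)) (map-∘ xs))
                  (map-cong-local (All.map rank-right (Allₚ.All-swap ys<xs))) ⟩
  map (length ys +_) (relabel xs) ++ relabel ys ∎
  where
  open ≡-Reasoning
  rank-left : ∀ {x} → All (_< x) ys → rank x (xs ++ ys) ≡ length ys + rank x xs
  rank-left ys<x = begin
    rank _ (xs ++ ys)          ≡⟨ rank-++ _ xs ys ⟩
    rank _ xs + rank _ ys      ≡⟨ cong (_ +_) (rank-all-below ys ys<x) ⟩
    rank _ xs + length ys      ≡⟨ +-comm _ (length ys) ⟩
    length ys + rank _ xs      ∎
  rank-right : ∀ {y} → All (y <_) xs → rank y (xs ++ ys) ≡ rank y ys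
  rank-right y<xs = trans (rank-++ _ xs ys) (cong (_+ _) (rank-all-above xs (All.map <⇒≤ y<xs)))

record IsPerm (m : ℕ) (r : List ℕ) : Set where
  field
    length≡ : length r ≡ m
    bounded : All (_< m) r
    unique : Unique r
open IsPerm public

length-filter-∁ : ∀ {P : ℕ → Set} (P? : Decidable P) xs →
                  length (filter P? xs) + length (filter (∁? P?) xs) ≡ length xs
length-filter-∁ P? [] = refl
length-filter-∁ P? (x ∷ xs) with does (P? x)
... | true = cong suc (length-filter-∁ P? xs)
... | false = trans (+-suc _ _) (cong suc (length-filter-∁ P? xs))

length-filter-≢ : ∀ h xs → Unique xs → length xs ≤ suc (length (filter (∁? (_≟ h)) xs))
length-filter-≢ h [] _ = z≤n
length-filter-≢ h (y ∷ ys) (y∉ys ∷ u) with y ≡ᵇ h in e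
... | true = ≤-reflexive (cong (suc ∘ length) (sym (filter-all (∁? (_≟ h)) ys≢h)))
  where
  y≡h = ≡ᵇ⇒≡ y h (Equivalence.from T-≡ e)
  ys≢h : All (_≢ h) ys
  ys≢h = All.map (λ y≢z z≡h → y≢z (trans y≡h (sym z≡h))) y∉ys
... | false = s≤s (length-filter-≢ h ys u)

unique-length-≤ : ∀ lo hi xs → Unique xs → All (λ y → lo ≤ y × y < hi) xs → length xs ≤ hi ∸ lo
unique-length-≤ lo hi [] _ _ = z≤n
unique-length-≤ lo zero (y ∷ ys) _ ((_ , ()) ∷ _)
unique-length-≤ lo (suc h) xs@(y ∷ _) u bnd@((lo≤y , y<1+h) ∷ _) = begin
  length xs             ≤⟨ length-filter-≢ h xs u ⟩
  suc (length xs′)      ≤⟨ s≤s (unique-length-≤ lo h xs′ (AllPairsₚ.filter⁺ (∁? (_≟ h)) u) bnd′) ⟩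
  suc (h ∸ lo)          ≡⟨ +-∸-assoc 1 (≤-trans lo≤y (≤-pred y<1+h)) ⟨
  suc h ∸ lo            ∎
  where
  open ≤-Reasoning
  xs′ = filter (∁? (_≟ h)) xs
  bnd′ : All (λ z → lo ≤ z × z < h) xs′
  bnd′ = All.zipWith (λ { ((lo≤z , z<1+h) , z≢h) → lo≤z , ≤∧≢⇒< (≤-pred z<1+h) z≢h })
                     (Allₚ.filter⁺ (∁? (_≟ h)) bnd , Allₚ.all-filter (∁? (_≟ h)) xs)

-- By pigeonhole at most x entries lie in [0, x) and at most m ∸ x in [x, m); as there are m
-- entries, both bounds are attained.
rank-perm : ∀ {m r x} → IsPerm m r → x < m → rank x r ≡ x
rank-perm {m} {r} {x} p x<m = ≤-antisym rank≤x x≤rank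
  where
  above = filter (∁? (_<? x)) r
  rank≤x : rank x r ≤ x
  rank≤x = unique-length-≤ 0 x _ (AllPairsₚ.filter⁺ (_<? x) (unique p))
             (All.map (z≤n ,_) (Allₚ.all-filter (_<? x) r))
  above≤ : length above ≤ m ∸ x
  above≤ = unique-length-≤ x m above (AllPairsₚ.filter⁺ (∁? (_<? x)) (unique p))
             (All.zipWith (λ (y≮x , y<m) → ≮⇒≥ y≮x , y<m)
                          (Allₚ.all-filter (∁? (_<? x)) r , Allₚ.filter⁺ (∁? (_<? x)) (bounded p)))
  x≤rank : x ≤ rank x r
  x≤rank = begin
    x                                   ≡⟨ m∸[m∸n]≡n (<⇒≤ x<m) ⟨
    m ∸ (m ∸ x)                         ≤⟨ ∸-monoʳ-≤ m above≤ ⟩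
    m ∸ length above                    ≡⟨ cong (_∸ length above) (trans (length-filter-∁ (_<? x) r) (length≡ p)) ⟨
    rank x r + length above ∸ length above ≡⟨ m+n∸n≡m (rank x r) (length above) ⟩
    rank x r                            ∎
    where open ≤-Reasoning

relabel-perm : ∀ {m r} → IsPerm m r → relabel r ≡ r
relabel-perm p = map-id-local (All.map (rank-perm p) (bounded p))

take-applyUpTo : ∀ (f : ℕ → ℕ) ℓ m → take ℓ (applyUpTo f m) ≡ applyUpTo f (ℓ ⊓ m)
take-applyUpTo f zero m = refl
take-applyUpTo f (suc ℓ) zero = refl
take-applyUpTo f (suc ℓ) (suc m) = cong (f 0 ∷_) (take-applyUpTo (f ∘ suc) ℓ m)

drop-applyUpTo : ∀ (f : ℕ → ℕ) ℓ m → drop ℓ (applyUpTo f m) ≡ applyUpTo (f ∘ (ℓ +_)) (m ∸ ℓ)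
drop-applyUpTo f zero m = refl
drop-applyUpTo f (suc ℓ) zero = refl
drop-applyUpTo f (suc ℓ) (suc m) = drop-applyUpTo (f ∘ suc) ℓ m

applyUpTo-++ : ∀ (f : ℕ → ℕ) a b → applyUpTo f (a + b) ≡ applyUpTo f a ++ applyUpTo (f ∘ (a +_)) b
applyUpTo-++ f zero b = refl
applyUpTo-++ f (suc a) b = cong (f 0 ∷_) (applyUpTo-++ (f ∘ suc) a b)

upTo-perm : ∀ m → IsPerm m (upTo m)
upTo-perm m = record { length≡ = length-upTo m ; bounded = Allₚ.all-upTo m ; unique = Uniqueₚ.upTo⁺ m }

relabel-upTo : ∀ m → relabel (upTo m) ≡ upTo m
relabel-upTo m = relabel-perm (upTo-perm m)

take-upTo : ∀ {ℓ m} → ℓ ≤ m → take ℓ (upTo m) ≡ upTo ℓ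
take-upTo {ℓ} {m} ℓ≤m = trans (take-applyUpTo id ℓ m) (cong upTo (m≤n⇒m⊓n≡m ℓ≤m))

drop-upTo : ∀ ℓ m → drop ℓ (upTo m) ≡ map (ℓ +_) (upTo (m ∸ ℓ))
drop-upTo ℓ m = trans (drop-applyUpTo id ℓ m) (sym (map-applyUpTo id (ℓ +_) (m ∸ ℓ)))

relabel-drop-upTo : ∀ ℓ m → relabel (drop ℓ (upTo m)) ≡ upTo (m ∸ ℓ)
relabel-drop-upTo ℓ m = begin
  relabel (drop ℓ (upTo m))               ≡⟨ cong relabel (drop-upTo ℓ m) ⟩
  relabel (map (ℓ +_) (upTo (m ∸ ℓ)))     ≡⟨ relabel-+ ℓ (upTo (m ∸ ℓ)) ⟩
  relabel (upTo (m ∸ ℓ))                  ≡⟨ relabel-upTo (m ∸ ℓ) ⟩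
  upTo (m ∸ ℓ)                            ∎
  where open ≡-Reasoning

upTo-+ : ∀ a b → upTo (a + b) ≡ upTo a ++ map (a +_) (upTo b)
upTo-+ a b = trans (applyUpTo-++ id a b) (cong (upTo a ++_) (sym (map-applyUpTo id (a +_) b)))

SplitsBy : (ℕ → ℕ → Set) → ℕ → List ℕ → Set
SplitsBy R ℓ xs = All (λ u → All (R u) (drop ℓ xs)) (take ℓ xs)

Ascends Descends : ℕ → List ℕ → Set
Ascends = SplitsBy _<_
Descends = SplitsBy _>_

splitsByᵇ : (ℕ → ℕ → Bool) → ℕ → List ℕ → Bool
splitsByᵇ r ℓ xs = all (λ u → all (r u) (drop ℓ xs)) (take ℓ xs)

-- splitsAt ℓ xs ≡ ascendsᵇ ℓ xs ∨ descendsᵇ ℓ xs holds definitionally.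
ascendsᵇ descendsᵇ : ℕ → List ℕ → Bool
ascendsᵇ = splitsByᵇ _<ᵇ_
descendsᵇ = splitsByᵇ (λ u v → v <ᵇ u)

ascendsᵇ⁻ : ∀ ℓ xs → ascendsᵇ ℓ xs ≡ true → Ascends ℓ xs
ascendsᵇ⁻ ℓ xs e = All.map (All.map <ᵇ-true⇒< ∘ all-true⁻ _) (all-true⁻ _ e)

ascendsᵇ⁺ : ∀ ℓ xs → Ascends ℓ xs → ascendsᵇ ℓ xs ≡ true
ascendsᵇ⁺ ℓ xs p = all-true⁺ (All.map (all-true⁺ ∘ All.map <⇒<ᵇ-true) p)

descendsᵇ⁻ : ∀ ℓ xs → descendsᵇ ℓ xs ≡ true → Descends ℓ xs
descendsᵇ⁻ ℓ xs e = All.map (All.map <ᵇ-true⇒< ∘ all-true⁻ _) (all-true⁻ _ e)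

descendsᵇ⁺ : ∀ ℓ xs → Descends ℓ xs → descendsᵇ ℓ xs ≡ true
descendsᵇ⁺ ℓ xs p = all-true⁺ (All.map (all-true⁺ ∘ All.map <⇒<ᵇ-true) p)

upTo-ascends : ∀ ℓ m → Ascends ℓ (upTo m)
upTo-ascends ℓ m rewrite take-applyUpTo id ℓ m | drop-applyUpTo id ℓ m =
  Allₚ.applyUpTo⁺₁ id (ℓ ⊓ m) λ i<ℓ⊓m →
    Allₚ.applyUpTo⁺₂ (ℓ +_) (m ∸ ℓ) λ j → <-≤-trans (<-≤-trans i<ℓ⊓m (m⊓n≤m ℓ m)) (m≤m+n ℓ j)

splitsAt-¬ascends : ∀ ℓ xs → splitsAt ℓ xs ≡ true → ascendsᵇ ℓ xs ≡ false → descendsᵇ ℓ xs ≡ true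
splitsAt-¬ascends ℓ xs split ¬ascends rewrite ¬ascends = split

All-drop-≤ : ∀ {P : ℕ → Set} {i j} (ys : List ℕ) → i ≤ j → All P (drop i ys) → All P (drop j ys)
All-drop-≤ {i = zero} {j} ys _ p = Allₚ.drop⁺ j p
All-drop-≤ {i = suc i} {suc j} [] _ p = []
All-drop-≤ {i = suc i} {suc j} (y ∷ ys) (s≤s i≤j) p = All-drop-≤ ys i≤j p

All-drop-witness : ∀ {P : ℕ → Set} j (ys : List ℕ) → j < length ys → All P (drop j ys) → ∃ P
All-drop-witness zero (y ∷ _) _ (py ∷ _) = y , py
All-drop-witness (suc j) (_ ∷ ys) (s<s j<n) p = All-drop-witness j ys j<n p

-- The first entry lies in both prefixes and the entry at position ℓ₁ ⊔ ℓ₂ in both suffixes.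
¬ascends×descends : ∀ {ℓ₁ ℓ₂} xs → 0 < ℓ₁ → 0 < ℓ₂ → ℓ₁ < length xs → ℓ₂ < length xs →
                    Ascends ℓ₁ xs → Descends ℓ₂ xs → ⊥
¬ascends×descends {suc ℓ₁} {suc ℓ₂} xs@(x ∷ _) _ _ ℓ₁<n ℓ₂<n (x<suffix₁ ∷ _) (x>suffix₂ ∷ _) =
  <-asym x<y y<x
  where
  j = suc ℓ₁ ⊔ suc ℓ₂
  witness = All-drop-witness j xs (⊔-lub ℓ₁<n ℓ₂<n)
              (All.zipWith id (All-drop-≤ xs (m≤m⊔n (suc ℓ₁) (suc ℓ₂)) x<suffix₁ ,
                               All-drop-≤ xs (m≤n⊔m (suc ℓ₁) (suc ℓ₂)) x>suffix₂))
  x<y = proj₁ (proj₂ witness)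
  y<x = proj₂ (proj₂ witness)

take-+ : ∀ a i (xs : List ℕ) → take (a + i) xs ≡ take a xs ++ take i (drop a xs)
take-+ zero i xs = refl
take-+ (suc a) i [] = sym (take-[] i)
take-+ (suc a) i (x ∷ xs) = cong (x ∷_) (take-+ a i xs)

take-take+ : ∀ a i (xs : List ℕ) → take a (take (a + i) xs) ≡ take a xs
take-take+ a i xs = trans (take-take a (a + i) xs) (cong (λ n → take n xs) (m≤n⇒m⊓n≡m (m≤m+n a i)))

drop-take+ : ∀ a i (xs : List ℕ) → drop a (take (a + i) xs) ≡ take i (drop a xs)
drop-take+ a i xs = sym (take-drop i a xs)

module _ (R : ℕ → ℕ → Set) where

  splitsBy-++ : ∀ ℓ i xs → SplitsBy R ℓ xs → SplitsBy R i (drop ℓ xs) → SplitsBy R (ℓ + i) xs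
  splitsBy-++ ℓ i xs p q rewrite take-+ ℓ i xs | sym (drop-drop ℓ i xs) =
    Allₚ.++⁺ (All.map (Allₚ.drop⁺ i) p) q

  splitsBy-take : ∀ ℓ i xs → SplitsBy R ℓ xs → SplitsBy R ℓ (take (ℓ + i) xs)
  splitsBy-take ℓ i xs p rewrite take-take+ ℓ i xs | drop-take+ ℓ i xs = All.map (Allₚ.take⁺ i) p

  splitsBy-drop : ∀ a i xs → SplitsBy R (a + i) xs → SplitsBy R i (drop a xs)
  splitsBy-drop a i xs p rewrite take-+ a i xs | sym (drop-drop a i xs) = Allₚ.++⁻ʳ (take a xs) p

module _ {r : ℕ → ℕ → Bool} {g : ℕ → ℕ} {Q : ℕ → Set}
         (r-invariant : ∀ {u v} → Q u → Q v → r (g u) (g v) ≡ r u v) where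

  splitsByᵇ-map : ∀ ℓ xs → All Q xs → splitsByᵇ r ℓ (map g xs) ≡ splitsByᵇ r ℓ xs
  splitsByᵇ-map ℓ xs qxs rewrite take-map {f = g} ℓ xs | drop-map {f = g} ℓ xs =
    trans (all-map g (take ℓ xs))
          (all-cong-local (Allₚ.take⁺ ℓ qxs) λ qu →
            trans (all-map g (drop ℓ xs)) (all-cong-local (Allₚ.drop⁺ ℓ qxs) (r-invariant qu)))

ascendsᵇ-relabel : ∀ ℓ xs → ascendsᵇ ℓ (relabel xs) ≡ ascendsᵇ ℓ xs
ascendsᵇ-relabel ℓ xs = splitsByᵇ-map (λ qu qv → rank-orderPreserving xs qv qu) ℓ xs (∈-self xs)

descendsᵇ-relabel : ∀ ℓ xs → descendsᵇ ℓ (relabel xs) ≡ descendsᵇ ℓ xs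
descendsᵇ-relabel ℓ xs = splitsByᵇ-map (rank-orderPreserving xs) ℓ xs (∈-self xs)

splitsAt-relabel : ∀ ℓ xs → splitsAt ℓ (relabel xs) ≡ splitsAt ℓ xs
splitsAt-relabel ℓ xs = cong₂ _∨_ (ascendsᵇ-relabel ℓ xs) (descendsᵇ-relabel ℓ xs)

-- Direct and skew sums of rows

-- The direct sum (δ = true) or skew sum (δ = false) of rows l and r of lengths a and b.
joinRow : Bool → ℕ → ℕ → List ℕ → List ℕ → List ℕ
joinRow true a b l r = l ++ map (a +_) r
joinRow false a b l r = map (b +_) l ++ r

take-length-++ : ∀ {n} (xs ys : List ℕ) → length xs ≡ n → take n (xs ++ ys) ≡ xs
take-length-++ [] ys refl = refl
take-length-++ (x ∷ xs) ys refl = cong (x ∷_) (take-length-++ xs ys refl)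

drop-length-++ : ∀ {n} (xs ys : List ℕ) → length xs ≡ n → drop n (xs ++ ys) ≡ ys
drop-length-++ [] ys refl = refl
drop-length-++ (x ∷ xs) ys refl = drop-length-++ xs ys refl

module _ {a b l r} (pl : IsPerm a l) (pr : IsPerm b r) where

  private
    length-shifted : length (map (b +_) l) ≡ a
    length-shifted = trans (length-map (b +_) l) (length≡ pl)

  take-joinRow : ∀ δ → take a (joinRow δ a b l r) ≡ (if δ then l else map (b +_) l)
  take-joinRow true = take-length-++ l _ (length≡ pl)
  take-joinRow false = take-length-++ (map (b +_) l) r length-shifted

  drop-joinRow : ∀ δ → drop a (joinRow δ a b l r) ≡ (if δ then map (a +_) r else r)
  drop-joinRow true = drop-length-++ l _ (length≡ pl)
  drop-joinRow false = drop-length-++ (map (b +_) l) r length-shifted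

  relabel-take-joinRow : ∀ δ → relabel (take a (joinRow δ a b l r)) ≡ l
  relabel-take-joinRow true = trans (cong relabel (take-joinRow true)) (relabel-perm pl)
  relabel-take-joinRow false =
    trans (cong relabel (take-joinRow false)) (trans (relabel-+ b l) (relabel-perm pl))

  relabel-drop-joinRow : ∀ δ → relabel (drop a (joinRow δ a b l r)) ≡ r
  relabel-drop-joinRow true =
    trans (cong relabel (drop-joinRow true)) (trans (relabel-+ a r) (relabel-perm pr))
  relabel-drop-joinRow false = trans (cong relabel (drop-joinRow false)) (relabel-perm pr)

  private
    l<shifted-r : All (λ x → All (x <_) (map (a +_) r)) l
    l<shifted-r = All.map (λ x<a → Allₚ.map⁺ (All.universal (λ y → <-≤-trans x<a (m≤m+n a y)) r)) (bounded pl)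

    shifted-l>r : All (λ x → All (_< x) r) (map (b +_) l)
    shifted-l>r = Allₚ.map⁺ (All.universal (λ x → All.map (λ y<b → <-≤-trans y<b (m≤m+n b x)) (bounded pr)) l)

  joinRow-ascends : Ascends a (joinRow true a b l r)
  joinRow-ascends rewrite take-joinRow true | drop-joinRow true = l<shifted-r

  joinRow-descends : Descends a (joinRow false a b l r)
  joinRow-descends rewrite take-joinRow false | drop-joinRow false = shifted-l>r

  length-joinRow : ∀ δ → length (joinRow δ a b l r) ≡ a + b
  length-joinRow true = trans (length-++ l) (cong₂ _+_ (length≡ pl) (trans (length-map _ r) (length≡ pr)))
  length-joinRow false = trans (length-++ (map (b +_) l)) (cong₂ _+_ length-shifted (length≡ pr))

  ascendsᵇ-joinRow : 0 < a → 0 < b → ∀ δ → ascendsᵇ a (joinRow δ a b l r) ≡ δ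
  ascendsᵇ-joinRow _ _ true = ascendsᵇ⁺ a _ joinRow-ascends
  ascendsᵇ-joinRow 0<a 0<b false with ascendsᵇ a (joinRow false a b l r) in e
  ... | false = refl
  ... | true = ⊥-elim (¬ascends×descends _ 0<a 0<a a<n a<n (ascendsᵇ⁻ a _ e) joinRow-descends)
    where
    a<n : a < length (joinRow false a b l r)
    a<n = subst (a <_) (sym (length-joinRow false)) (m<m+n a 0<b)

  splitsAt-joinRow : ∀ δ → splitsAt a (joinRow δ a b l r) ≡ true
  splitsAt-joinRow true = ∨-introˡ (ascendsᵇ⁺ a _ joinRow-ascends)
  splitsAt-joinRow false = ∨-introʳ {ascendsᵇ a _} (descendsᵇ⁺ a _ joinRow-descends)

  joinRow-perm : ∀ δ → IsPerm (a + b) (joinRow δ a b l r)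
  joinRow-perm true = record
    { length≡ = length-joinRow true
    ; bounded = Allₚ.++⁺ (All.map (λ x<a → <-≤-trans x<a (m≤m+n a b)) (bounded pl))
                         (Allₚ.map⁺ (All.map (+-monoʳ-< a) (bounded pr)))
    ; unique = AllPairsₚ.++⁺ (unique pl) (AllPairsₚ.map⁺ (AllPairs.map (λ x≢y → x≢y ∘ +-cancelˡ-≡ a _ _) (unique pr)))
                             (All.map (All.map <⇒≢) l<shifted-r)
    }
  joinRow-perm false = record
    { length≡ = length-joinRow false
    ; bounded = Allₚ.++⁺ (Allₚ.map⁺ (All.map (λ {x} x<a → subst (b + x <_) (+-comm b a) (+-monoʳ-< b x<a)) (bounded pl)))
                         (All.map (λ y<b → <-≤-trans y<b (m≤n+m b a)) (bounded pr))
    ; unique = AllPairsₚ.++⁺ (AllPairsₚ.map⁺ (AllPairs.map (λ x≢y → x≢y ∘ +-cancelˡ-≡ b _ _) (unique pl))) (unique pr)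
                             (All.map (All.map >⇒≢) shifted-l>r)
    }

Standard : ℕ → List ℕ → Set
Standard m xs = length xs ≡ m × relabel xs ≡ xs

joinRow-split : ∀ {ℓ m xs} → ℓ ≤ m → Standard m xs → splitsAt ℓ xs ≡ true →
                joinRow (ascendsᵇ ℓ xs) ℓ (m ∸ ℓ) (relabel (take ℓ xs)) (relabel (drop ℓ xs)) ≡ xs
joinRow-split {ℓ} {m} {xs} ℓ≤m (length≡m , fixed) split with ascendsᵇ ℓ xs in e
... | true = sym (begin
  xs                                                           ≡⟨ fixed ⟨
  relabel xs                                                   ≡⟨ cong relabel (take++drop≡id ℓ xs) ⟨
  relabel (take ℓ xs ++ drop ℓ xs)                             ≡⟨ relabel-++-ascending _ _ (ascendsᵇ⁻ ℓ xs e) ⟩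
  relabel (take ℓ xs) ++ map (length (take ℓ xs) +_) (relabel (drop ℓ xs))
    ≡⟨ cong (λ n → relabel (take ℓ xs) ++ map (n +_) (relabel (drop ℓ xs))) length-take≡ ⟩
  relabel (take ℓ xs) ++ map (ℓ +_) (relabel (drop ℓ xs))     ∎)
  where
  open ≡-Reasoning
  length-take≡ : length (take ℓ xs) ≡ ℓ
  length-take≡ = trans (length-take ℓ xs) (trans (cong (ℓ ⊓_) length≡m) (m≤n⇒m⊓n≡m ℓ≤m))
... | false = sym (begin
  xs                                                           ≡⟨ fixed ⟨
  relabel xs                                                   ≡⟨ cong relabel (take++drop≡id ℓ xs) ⟨
  relabel (take ℓ xs ++ drop ℓ xs)                             ≡⟨ relabel-++-descending _ _ (descendsᵇ⁻ ℓ xs split) ⟩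
  map (length (drop ℓ xs) +_) (relabel (take ℓ xs)) ++ relabel (drop ℓ xs)
    ≡⟨ cong (λ n → map (n +_) (relabel (take ℓ xs)) ++ relabel (drop ℓ xs)) length-drop≡ ⟩
  map ((m ∸ ℓ) +_) (relabel (take ℓ xs)) ++ relabel (drop ℓ xs) ∎)
  where
  open ≡-Reasoning
  length-drop≡ : length (drop ℓ xs) ≡ m ∸ ℓ
  length-drop≡ = trans (length-drop ℓ xs) (cong (_∸ ℓ) length≡m)

Rows : Set
Rows = List (List ℕ)

leftParts rightParts : ℕ → Rows → Rows
leftParts ℓ = map (λ xs → relabel (take ℓ xs))
rightParts ℓ = map (λ xs → relabel (drop ℓ xs))

splitTest : ℕ → ℕ → Rows → ℕ → Bool
splitTest f m rows ℓ =
  (0 <ᵇ ℓ) ∧ all (splitsAt ℓ) rows ∧ sepAux f ℓ (leftParts ℓ rows) ∧ sepAux f (m ∸ ℓ) (rightParts ℓ rows)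

record IsSplit (f m : ℕ) (rows : Rows) (ℓ : ℕ) : Set where
  constructor isSplit
  field
    positive : 0 < ℓ
    splits : all (splitsAt ℓ) rows ≡ true
    left-separable : sepAux f ℓ (leftParts ℓ rows) ≡ true
    right-separable : sepAux f (m ∸ ℓ) (rightParts ℓ rows) ≡ true

splitTest⁻ : ∀ {f m rows ℓ} → splitTest f m rows ℓ ≡ true → IsSplit f m rows ℓ
splitTest⁻ {rows = rows} {ℓ} e = isSplit (<ᵇ-true⇒< {0} {ℓ} (∧-elimˡ e)) (∧-elimˡ e₁) (∧-elimˡ e₂) (∧-elimʳ e₂)
  where
  e₁ = ∧-elimʳ {0 <ᵇ ℓ} e
  e₂ = ∧-elimʳ {all (splitsAt ℓ) rows} e₁

splitTest⁺ : ∀ {f m rows ℓ} → IsSplit f m rows ℓ → splitTest f m rows ℓ ≡ true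
splitTest⁺ (isSplit 0<ℓ s l r) = ∧-intro (<⇒<ᵇ-true 0<ℓ) (∧-intro s (∧-intro l r))

sepAux⁻ : ∀ f m rows → sepAux (suc f) m rows ≡ true → m ≡ 1 ⊎ ∃ λ ℓ → ℓ < m × IsSplit f m rows ℓ
sepAux⁻ f m rows e with ∨-elim {m ≡ᵇ 1} e
... | inj₁ m≡ᵇ1 = inj₁ (≡ᵇ⇒≡ m 1 (Equivalence.from T-≡ m≡ᵇ1))
... | inj₂ e′ with ℓ , ℓ<m , test ← any-upTo⁻ (splitTest f m rows) m (∧-elimʳ e′) =
  inj₂ (ℓ , ℓ<m , splitTest⁻ test)

sepAux⁺ : ∀ f m rows ℓ → ℓ < m → IsSplit f m rows ℓ → sepAux (suc f) m rows ≡ true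
sepAux⁺ f m rows ℓ ℓ<m split = ∨-introʳ {m ≡ᵇ 1}
  (∧-intro (<⇒<ᵇ-true (<-≤-trans (s≤s (IsSplit.positive split)) ℓ<m))
           (any-upTo⁺ (splitTest f m rows) ℓ<m (splitTest⁺ split)))

sepAux-suc : ∀ f m rows → sepAux f m rows ≡ true → sepAux (suc f) m rows ≡ true
sepAux-suc (suc f) m rows e with sepAux⁻ f m rows e
... | inj₁ refl = refl
... | inj₂ (ℓ , ℓ<m , isSplit 0<ℓ s l r) =
  sepAux⁺ (suc f) m rows ℓ ℓ<m (isSplit 0<ℓ s (sepAux-suc f ℓ _ l) (sepAux-suc f (m ∸ ℓ) _ r))

sepAux-pred : ∀ f m rows → m ≤ f → sepAux (suc f) m rows ≡ true → sepAux f m rows ≡ true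
sepAux-pred zero zero rows z≤n ()
sepAux-pred (suc f) m rows m≤1+f e with sepAux⁻ (suc f) m rows e
... | inj₁ refl = refl
... | inj₂ (ℓ , ℓ<m , isSplit 0<ℓ s l r) = sepAux⁺ f m rows ℓ ℓ<m (isSplit 0<ℓ s
        (sepAux-pred f ℓ _ (≤-pred (<-≤-trans ℓ<m m≤1+f)) l)
        (sepAux-pred f (m ∸ ℓ) _ (≤-pred (<-≤-trans (∸-monoʳ-< 0<ℓ (<⇒≤ ℓ<m)) m≤1+f)) r))

findLast : (ℕ → Bool) → ℕ → Maybe ℕ
findLast p zero = nothing
findLast p (suc m) = if p m then just m else findLast p m

IsLast : (ℕ → Bool) → ℕ → ℕ → Set
IsLast p m ℓ = p ℓ ≡ true × ℓ < m × (∀ j → ℓ < j → j < m → p j ≡ false)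

findLast-just : ∀ p m {ℓ} → findLast p m ≡ just ℓ → IsLast p m ℓ
findLast-just p (suc m) e with p m in pm
findLast-just p (suc m) refl | true = pm , ≤-refl , λ j m<j j<1+m → contradiction (≤-pred j<1+m) (<⇒≱ m<j)
... | false with pℓ , ℓ<m , after ← findLast-just p m e =
  pℓ , m≤n⇒m≤1+n ℓ<m , λ j ℓ<j j<1+m → [ after j ℓ<j , (λ { refl → pm }) ]′ (m≤n⇒m<n∨m≡n (≤-pred j<1+m))

findLast-nothing : ∀ p m → findLast p m ≡ nothing → ∀ j → j < m → p j ≡ false
findLast-nothing p (suc m) e j j<1+m with p m in pm
findLast-nothing p (suc m) () j j<1+m | true
... | false = [ findLast-nothing p m e j , (λ { refl → pm }) ]′ (m≤n⇒m<n∨m≡n (≤-pred j<1+m))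

findLast-last : ∀ p m ℓ → IsLast p m ℓ → findLast p m ≡ just ℓ
findLast-last p (suc m) ℓ (pℓ , ℓ<1+m , after) with m≤n⇒m<n∨m≡n (≤-pred ℓ<1+m)
... | inj₁ ℓ<m rewrite after m ℓ<m ≤-refl =
  findLast-last p m ℓ (pℓ , ℓ<m , λ j ℓ<j j<m → after j ℓ<j (m≤n⇒m≤1+n j<m))
... | inj₂ refl rewrite pℓ = refl

lastSplit-nothing : ∀ f m rows → sepAux (suc f) m rows ≡ true → findLast (splitTest f m rows) m ≡ nothing → m ≡ 1
lastSplit-nothing f m rows sep none with sepAux⁻ f m rows sep
... | inj₁ m≡1 = m≡1
... | inj₂ (ℓ , ℓ<m , split) = ⊥-elim (true≢false (trans (sym (splitTest⁺ split)) (findLast-nothing _ m none ℓ ℓ<m)))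

lastSplit-just : ∀ f m rows {ℓ} → findLast (splitTest f m rows) m ≡ just ℓ → ℓ < m × IsSplit f m rows ℓ
lastSplit-just f m rows last with test , ℓ<m , _ ← findLast-just _ m last = ℓ<m , splitTest⁻ test

joinRows : List Bool → ℕ → ℕ → Rows → Rows → Rows
joinRows (δ ∷ δs) a b (l ∷ ls) (r ∷ rs) = joinRow δ a b l r ∷ joinRows δs a b ls rs
joinRows _ _ _ _ _ = []

joinRows-cong : ∀ {δs δs′ a a′ b b′ ls ls′ rs rs′} → δs ≡ δs′ → a ≡ a′ → b ≡ b′ → ls ≡ ls′ → rs ≡ rs′ →
                joinRows δs a b ls rs ≡ joinRows δs′ a′ b′ ls′ rs′
joinRows-cong refl refl refl refl refl = refl

module _ {a b : ℕ} where

  joinRows-perm : ∀ δs {ls rs} → All (IsPerm a) ls → All (IsPerm b) rs → All (IsPerm (a + b)) (joinRows δs a b ls rs)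
  joinRows-perm (δ ∷ δs) (pl ∷ pls) (pr ∷ prs) = joinRow-perm pl pr δ ∷ joinRows-perm δs pls prs
  joinRows-perm [] _ _ = []
  joinRows-perm (_ ∷ _) [] _ = []
  joinRows-perm (_ ∷ _) (_ ∷ _) [] = []

  splitsAt-joinRows : ∀ δs {ls rs} → All (IsPerm a) ls → All (IsPerm b) rs → all (splitsAt a) (joinRows δs a b ls rs) ≡ true
  splitsAt-joinRows (δ ∷ δs) (pl ∷ pls) (pr ∷ prs) = ∧-intro (splitsAt-joinRow pl pr δ) (splitsAt-joinRows δs pls prs)
  splitsAt-joinRows [] _ _ = refl
  splitsAt-joinRows (_ ∷ _) [] _ = refl
  splitsAt-joinRows (_ ∷ _) (_ ∷ _) [] = refl

  length-joinRows : ∀ δs ls rs → length ls ≡ length δs → length rs ≡ length δs →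
                    length (joinRows δs a b ls rs) ≡ length δs
  length-joinRows [] [] [] _ _ = refl
  length-joinRows (δ ∷ δs) (l ∷ ls) (r ∷ rs) e₁ e₂ =
    cong suc (length-joinRows δs ls rs (suc-injective e₁) (suc-injective e₂))

  leftParts-joinRows : ∀ δs {ls rs} → All (IsPerm a) ls → All (IsPerm b) rs →
                       length ls ≡ length δs → length rs ≡ length δs → leftParts a (joinRows δs a b ls rs) ≡ ls
  leftParts-joinRows [] [] [] _ _ = refl
  leftParts-joinRows (δ ∷ δs) (pl ∷ pls) (pr ∷ prs) e₁ e₂ =
    cong₂ _∷_ (relabel-take-joinRow pl pr δ) (leftParts-joinRows δs pls prs (suc-injective e₁) (suc-injective e₂))

  rightParts-joinRows : ∀ δs {ls rs} → All (IsPerm a) ls → All (IsPerm b) rs →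
                        length ls ≡ length δs → length rs ≡ length δs → rightParts a (joinRows δs a b ls rs) ≡ rs
  rightParts-joinRows [] [] [] _ _ = refl
  rightParts-joinRows (δ ∷ δs) (pl ∷ pls) (pr ∷ prs) e₁ e₂ =
    cong₂ _∷_ (relabel-drop-joinRow pl pr δ) (rightParts-joinRows δs pls prs (suc-injective e₁) (suc-injective e₂))

  ascendsᵇ-joinRows : 0 < a → 0 < b → ∀ δs {ls rs} → All (IsPerm a) ls → All (IsPerm b) rs →
                      length ls ≡ length δs → length rs ≡ length δs → map (ascendsᵇ a) (joinRows δs a b ls rs) ≡ δs
  ascendsᵇ-joinRows 0<a 0<b [] [] [] _ _ = refl
  ascendsᵇ-joinRows 0<a 0<b (δ ∷ δs) (pl ∷ pls) (pr ∷ prs) e₁ e₂ =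
    cong₂ _∷_ (ascendsᵇ-joinRow pl pr 0<a 0<b δ) (ascendsᵇ-joinRows 0<a 0<b δs pls prs (suc-injective e₁) (suc-injective e₂))

joinRows-split : ∀ {ℓ m} rows → ℓ ≤ m → All (Standard m) rows → all (splitsAt ℓ) rows ≡ true →
                 joinRows (map (ascendsᵇ ℓ) rows) ℓ (m ∸ ℓ) (leftParts ℓ rows) (rightParts ℓ rows) ≡ rows
joinRows-split [] _ _ _ = refl
joinRows-split {ℓ} (xs ∷ rows) ℓ≤m (sx ∷ sxs) s =
  cong₂ _∷_ (joinRow-split ℓ≤m sx (∧-elimˡ s)) (joinRows-split rows ℓ≤m sxs (∧-elimʳ {splitsAt ℓ xs} s))

splitsBy-map⁻ : ∀ {R : ℕ → ℕ → Set} {g} → (∀ {u v} → R (g u) (g v) → R u v) →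
                ∀ ℓ xs → SplitsBy R ℓ (map g xs) → SplitsBy R ℓ xs
splitsBy-map⁻ {g = g} reflect ℓ xs p rewrite take-map {f = g} ℓ xs | drop-map {f = g} ℓ xs =
  All.map (All.map reflect ∘ Allₚ.map⁻) (Allₚ.map⁻ p)

inside-right-summand : ∀ {a b j r} → IsPerm b r → a < j → j < a + b → j ∸ a < length r
inside-right-summand {a} {b} {j} pr a<j j<a+b =
  subst (j ∸ a <_) (trans (m+n∸m≡n a b) (sym (length≡ pr))) (∸-monoˡ-< j<a+b (<⇒≤ a<j))

-- If the sum of l and r splits at a position j inside r, where r is itself a sum of
-- direction δ′, then the outer sum has direction δ′ too: otherwise r would split in both directions.
joinRow-inner-direction :
  ∀ {a b a′ b′ l l′ r′ j} δ δ′ → IsPerm a l → IsPerm b (joinRow δ′ a′ b′ l′ r′) → IsPerm a′ l′ → IsPerm b′ r′ →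
  0 < a → 0 < a′ → 0 < b′ → a < j → j < a + b →
  splitsAt j (joinRow δ a b l (joinRow δ′ a′ b′ l′ r′)) ≡ true → δ ≡ δ′
joinRow-inner-direction true true _ _ _ _ _ _ _ _ _ _ = refl
joinRow-inner-direction false false _ _ _ _ _ _ _ _ _ _ = refl
joinRow-inner-direction {a} {b} {a′} {b′} {l} {l′} {r′} {j} true false pl pr pl′ pr′ 0<a 0<a′ 0<b′ a<j j<a+b split
  with ∨-elim {ascendsᵇ j (joinRow true a b l (joinRow false a′ b′ l′ r′))} split
... | inj₂ d = ⊥-elim (¬ascends×descends _ 0<a (<-trans 0<a a<j) (<-trans a<j j<n) j<n
                  (joinRow-ascends pl pr) (descendsᵇ⁻ j _ d))
  where j<n = subst (j <_) (sym (length-joinRow pl pr true)) j<a+b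
... | inj₁ u = ⊥-elim (¬ascends×descends _ (m<n⇒0<n∸m a<j) 0<a′ (inside-right-summand pr a<j j<a+b) a′<n
                  r-ascends (joinRow-descends pl′ pr′))
  where
  a′<n = subst (a′ <_) (sym (length-joinRow pl′ pr′ false)) (m<m+n a′ 0<b′)
  r-ascends : Ascends (j ∸ a) (joinRow false a′ b′ l′ r′)
  r-ascends = splitsBy-map⁻ (+-cancelˡ-< a _ _) (j ∸ a) _
                (subst (Ascends (j ∸ a)) (drop-joinRow pl pr true)
                  (splitsBy-drop _<_ a (j ∸ a) _
                    (subst (λ n → Ascends n _) (sym (m+[n∸m]≡n (<⇒≤ a<j))) (ascendsᵇ⁻ j _ u))))
joinRow-inner-direction {a} {b} {a′} {b′} {l} {l′} {r′} {j} false true pl pr pl′ pr′ 0<a 0<a′ 0<b′ a<j j<a+b split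
  with ∨-elim {ascendsᵇ j (joinRow false a b l (joinRow true a′ b′ l′ r′))} split
... | inj₁ u = ⊥-elim (¬ascends×descends _ (<-trans 0<a a<j) 0<a j<n (<-trans a<j j<n)
                  (ascendsᵇ⁻ j _ u) (joinRow-descends pl pr))
  where j<n = subst (j <_) (sym (length-joinRow pl pr false)) j<a+b
... | inj₂ d = ⊥-elim (¬ascends×descends _ 0<a′ (m<n⇒0<n∸m a<j) a′<n (inside-right-summand pr a<j j<a+b)
                  (joinRow-ascends pl′ pr′) r-descends)
  where
  a′<n = subst (a′ <_) (sym (length-joinRow pl′ pr′ true)) (m<m+n a′ 0<b′)
  r-descends : Descends (j ∸ a) (joinRow true a′ b′ l′ r′)
  r-descends = subst (Descends (j ∸ a)) (drop-joinRow pl pr false)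
                 (splitsBy-drop _>_ a (j ∸ a) _
                   (subst (λ n → Descends n _) (sym (m+[n∸m]≡n (<⇒≤ a<j))) (descendsᵇ⁻ j _ d)))

joinRows-inner-directions :
  ∀ {a b a′ b′ j} δs δs′ {ls ls′ rs′} → 0 < a → 0 < a′ → 0 < b′ → a < j → j < a + b →
  All (IsPerm a) ls → All (IsPerm b) (joinRows δs′ a′ b′ ls′ rs′) → All (IsPerm a′) ls′ → All (IsPerm b′) rs′ →
  length ls ≡ length δs → length ls′ ≡ length δs → length rs′ ≡ length δs → length δs′ ≡ length δs →
  all (splitsAt j) (joinRows δs a b ls (joinRows δs′ a′ b′ ls′ rs′)) ≡ true → δs ≡ δs′
joinRows-inner-directions [] [] _ _ _ _ _ _ _ _ _ _ _ _ _ _ = refl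
joinRows-inner-directions {a} {b} {a′} {b′} {j} (δ ∷ δs) (δ′ ∷ δs′) {l ∷ ls} {l′ ∷ ls′} {r′ ∷ rs′}
  0<a 0<a′ 0<b′ a<j j<a+b (pl ∷ pls) (pr ∷ prs) (pl′ ∷ pls′) (pr′ ∷ prs′) e₁ e₂ e₃ e₄ split =
  cong₂ _∷_ (joinRow-inner-direction δ δ′ pl pr pl′ pr′ 0<a 0<a′ 0<b′ a<j j<a+b (∧-elimˡ split))
            (joinRows-inner-directions δs δs′ 0<a 0<a′ 0<b′ a<j j<a+b pls prs pls′ prs′
               (suc-injective e₁) (suc-injective e₂) (suc-injective e₃) (suc-injective e₄)
               (∧-elimʳ {splitsAt j (joinRow δ a b l (joinRow δ′ a′ b′ l′ r′))} split))

standard-leftParts : ∀ {ℓ m} rows → ℓ ≤ m → All (Standard m) rows → All (Standard ℓ) (leftParts ℓ rows)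
standard-leftParts {ℓ} rows ℓ≤m std = Allₚ.map⁺ (All.map (λ {xs} (length≡m , _) →
  trans (length-map _ (take ℓ xs)) (trans (length-take ℓ xs) (trans (cong (ℓ ⊓_) length≡m) (m≤n⇒m⊓n≡m ℓ≤m))) ,
  relabel-idem (take ℓ xs)) std)

standard-rightParts : ∀ {ℓ m} rows → All (Standard m) rows → All (Standard (m ∸ ℓ)) (rightParts ℓ rows)
standard-rightParts {ℓ} rows std = Allₚ.map⁺ (All.map (λ {xs} (length≡m , _) →
  trans (length-map _ (drop ℓ xs)) (trans (length-drop ℓ xs) (cong (_∸ ℓ) length≡m)) ,
  relabel-idem (drop ℓ xs)) std)

standard-1 : ∀ {xs} → Standard 1 xs → xs ≡ [ 0 ]
standard-1 {x ∷ []} (_ , fixed) rewrite ≥⇒<ᵇ-false {x} {x} ≤-refl = sym fixed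

replicate-standard : ∀ n rest → length rest ≡ n → All (Standard 1) rest → replicate n [ 0 ] ≡ rest
replicate-standard zero [] _ _ = refl
replicate-standard (suc n) (xs ∷ rest) e (sx ∷ std) =
  cong₂ _∷_ (sym (standard-1 sx)) (replicate-standard n rest (suc-injective e) std)

leftParts-leftParts : ∀ ℓ i rows → leftParts ℓ (leftParts (ℓ + i) rows) ≡ leftParts ℓ rows
leftParts-leftParts ℓ i rows = trans (sym (map-∘ rows)) (map-cong part≡ rows)
  where
  part≡ : ∀ xs → relabel (take ℓ (relabel (take (ℓ + i) xs))) ≡ relabel (take ℓ xs)
  part≡ xs = trans (relabel-take ℓ (take (ℓ + i) xs)) (cong relabel (take-take+ ℓ i xs))

rightParts-leftParts : ∀ ℓ i rows → rightParts ℓ (leftParts (ℓ + i) rows) ≡ leftParts i (rightParts ℓ rows)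
rightParts-leftParts ℓ i rows = trans (sym (map-∘ rows)) (trans (map-cong part≡ rows) (map-∘ rows))
  where
  part≡ : ∀ xs → relabel (drop ℓ (relabel (take (ℓ + i) xs))) ≡ relabel (take i (relabel (drop ℓ xs)))
  part≡ xs = trans (relabel-drop ℓ (take (ℓ + i) xs))
                   (trans (cong relabel (drop-take+ ℓ i xs)) (sym (relabel-take i (drop ℓ xs))))

rightParts-rightParts : ∀ ℓ i rows → rightParts i (rightParts ℓ rows) ≡ rightParts (ℓ + i) rows
rightParts-rightParts ℓ i rows = trans (sym (map-∘ rows)) (map-cong part≡ rows)
  where
  part≡ : ∀ xs → relabel (drop i (relabel (drop ℓ xs))) ≡ relabel (drop (ℓ + i) xs)
  part≡ xs = trans (relabel-drop i (drop ℓ xs)) (cong relabel (drop-drop ℓ i xs))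

splitsAt-+ : ∀ ℓ i xs → splitsAt ℓ xs ≡ true → splitsAt i (relabel (drop ℓ xs)) ≡ true →
             ascendsᵇ ℓ xs ≡ ascendsᵇ i (relabel (drop ℓ xs)) → splitsAt (ℓ + i) xs ≡ true
splitsAt-+ ℓ i xs split₁ split₂ same with ascendsᵇ ℓ xs in e
... | true = ∨-introˡ (ascendsᵇ⁺ (ℓ + i) xs (splitsBy-++ _<_ ℓ i xs (ascendsᵇ⁻ ℓ xs e)
               (ascendsᵇ⁻ i (drop ℓ xs) (trans (sym (ascendsᵇ-relabel i (drop ℓ xs))) (sym same)))))
... | false = ∨-introʳ {ascendsᵇ (ℓ + i) xs} (descendsᵇ⁺ (ℓ + i) xs (splitsBy-++ _>_ ℓ i xs (descendsᵇ⁻ ℓ xs split₁)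
               (descendsᵇ⁻ i (drop ℓ xs) (trans (sym (descendsᵇ-relabel i (drop ℓ xs)))
                 (splitsAt-¬ascends i _ split₂ (sym same))))))

splitsAt-take : ∀ ℓ i xs → splitsAt ℓ xs ≡ true → splitsAt ℓ (relabel (take (ℓ + i) xs)) ≡ true
splitsAt-take ℓ i xs split rewrite splitsAt-relabel ℓ (take (ℓ + i) xs) with ascendsᵇ ℓ xs in e
... | true = ∨-introˡ (ascendsᵇ⁺ ℓ _ (splitsBy-take _<_ ℓ i xs (ascendsᵇ⁻ ℓ xs e)))
... | false = ∨-introʳ {ascendsᵇ ℓ (take (ℓ + i) xs)}
                (descendsᵇ⁺ ℓ _ (splitsBy-take _>_ ℓ i xs (descendsᵇ⁻ ℓ xs split)))

isSplit-+ : ∀ f m rows ℓ ℓʳ → ℓ + ℓʳ < m → ℓ ≤ f →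
            IsSplit (suc f) m rows ℓ → IsSplit f (m ∸ ℓ) (rightParts ℓ rows) ℓʳ →
            map (ascendsᵇ ℓ) rows ≡ map (ascendsᵇ ℓʳ) (rightParts ℓ rows) →
            IsSplit (suc f) m rows (ℓ + ℓʳ)
isSplit-+ f m rows ℓ ℓʳ ℓ+ℓʳ<m ℓ≤f (isSplit 0<ℓ splits sepˡ sepʳ) (isSplit 0<ℓʳ splitsʳ sepʳˡ sepʳʳ) same =
  isSplit (<-≤-trans 0<ℓ (m≤m+n ℓ ℓʳ)) (all-true⁺ splits-+) left-separable right-separable
  where
  same-pointwise : All (λ xs → ascendsᵇ ℓ xs ≡ ascendsᵇ ℓʳ (relabel (drop ℓ xs))) rows
  same-pointwise = map-≡⇒All rows (trans same (sym (map-∘ rows)))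
  splits-+ : All (λ xs → splitsAt (ℓ + ℓʳ) xs ≡ true) rows
  splits-+ = All.zipWith (λ (s , sʳ , d) → splitsAt-+ ℓ ℓʳ _ s sʳ d)
               (all-true⁻ rows splits , All.zipWith id (Allₚ.map⁻ (all-true⁻ _ splitsʳ) , same-pointwise))
  inner = leftParts (ℓ + ℓʳ) rows
  left-separable : sepAux (suc f) (ℓ + ℓʳ) inner ≡ true
  left-separable = sepAux⁺ f (ℓ + ℓʳ) inner ℓ (m<m+n ℓ 0<ℓʳ) (isSplit 0<ℓ
    (all-true⁺ (Allₚ.map⁺ (All.map (splitsAt-take ℓ ℓʳ _) (all-true⁻ rows splits))))
    (subst (λ rs → sepAux f ℓ rs ≡ true) (sym (leftParts-leftParts ℓ ℓʳ rows)) (sepAux-pred f ℓ _ ℓ≤f sepˡ))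
    (subst₂ (λ n rs → sepAux f n rs ≡ true) (sym (m+n∸m≡n ℓ ℓʳ)) (sym (rightParts-leftParts ℓ ℓʳ rows)) sepʳˡ))
  right-separable : sepAux (suc f) (m ∸ (ℓ + ℓʳ)) (rightParts (ℓ + ℓʳ) rows) ≡ true
  right-separable = sepAux-suc f _ _
    (subst₂ (λ n rs → sepAux f n rs ≡ true) (∸-+-assoc m ℓ ℓʳ) (rightParts-rightParts ℓ ℓʳ rows) sepʳʳ)

funToFin-cong : ∀ {m n} {f g : Fin m → Fin n} → f ≗ g → funToFin f ≡ funToFin g
funToFin-cong {zero} _ = refl
funToFin-cong {suc m} f≗g = cong₂ combine (f≗g _) (funToFin-cong (f≗g ∘ Fin.suc))

bits : ∀ k → Fin (2 ^ k) → Vec Bool k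
bits k c = tabulate (Inverse.to 2↔Bool ∘ finToFun {2} {k} c)

fromBits : ∀ {k} → Vec Bool k → Fin (2 ^ k)
fromBits {k} v = funToFin {k} {2} (Inverse.from 2↔Bool ∘ Vec.lookup v)

fromBits-bits : ∀ {k} (c : Fin (2 ^ k)) → fromBits (bits k c) ≡ c
fromBits-bits {k} c = begin
  fromBits (bits k c)                  ≡⟨ funToFin-cong {k} {2} from∘lookup ⟩
  funToFin {k} {2} (finToFun {2} {k} c) ≡⟨ funToFin-finToFin {k} {2} c ⟩
  c                                    ∎
  where
  open ≡-Reasoning
  from∘lookup : ∀ i → Inverse.from 2↔Bool (Vec.lookup (bits k c) i) ≡ finToFun {2} {k} c i
  from∘lookup i = trans (cong (Inverse.from 2↔Bool) (lookup∘tabulate (Inverse.to 2↔Bool ∘ finToFun {2} {k} c) i))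
                        (Inverse.strictlyInverseʳ 2↔Bool _)

bits-fromBits : ∀ {k} (v : Vec Bool k) → bits k (fromBits v) ≡ v
bits-fromBits {k} v = begin
  bits k (fromBits v)        ≡⟨ tabulate-cong to∘finToFun ⟩
  tabulate (Vec.lookup v)    ≡⟨ tabulate∘lookup v ⟩
  v                          ∎
  where
  open ≡-Reasoning
  g = Inverse.from 2↔Bool ∘ Vec.lookup v
  to∘finToFun : ∀ i → Inverse.to 2↔Bool (finToFun {2} {k} (funToFin {k} {2} g) i) ≡ Vec.lookup v i
  to∘finToFun i = trans (cong (Inverse.to 2↔Bool) (finToFun-funToFin {k} {2} g i)) (Inverse.strictlyInverseˡ 2↔Bool _)

-- Reads a list of length k as a vector.
toVec : ∀ k → List Bool → Vec Bool k
toVec zero _ = []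
toVec (suc k) [] = false ∷ toVec k []
toVec (suc k) (b ∷ bs) = b ∷ toVec k bs

toVec-toList : ∀ {k} (v : Vec Bool k) → toVec k (toList v) ≡ v
toVec-toList [] = refl
toVec-toList (b ∷ v) = cong (b ∷_) (toVec-toList v)

toList-toVec : ∀ k bs → length bs ≡ k → toList (toVec k bs) ≡ bs
toList-toVec zero [] _ = refl
toList-toVec (suc k) (b ∷ bs) e = cong (b ∷_) (toList-toVec k bs (suc-injective e))

toList-bits-injective : ∀ {k} {c c′ : Fin (2 ^ k)} → toList (bits k c) ≡ toList (bits k c′) → c ≡ c′
toList-bits-injective {k} {c} {c′} e = begin
  c                                        ≡⟨ fromBits-bits {k} c ⟨
  fromBits (bits k c)                      ≡⟨ cong fromBits (toVec-toList (bits k c)) ⟨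
  fromBits (toVec k (toList (bits k c)))   ≡⟨ cong (fromBits ∘ toVec k) e ⟩
  fromBits (toVec k (toList (bits k c′)))  ≡⟨ cong fromBits (toVec-toList (bits k c′)) ⟩
  fromBits (bits k c′)                     ≡⟨ fromBits-bits {k} c′ ⟩
  c′                                       ∎
  where open ≡-Reasoning

Matrix : ℕ → ℕ → Set
Matrix d m = Vec (Vec (Fin m) m) d

rowList : ∀ {m n} → Vec (Fin m) n → List ℕ
rowList v = map toℕ (toList v)

-- separable P ≡ sepAux m m (rowsOfMatrix P) holds definitionally.
rowsOfMatrix : ∀ {d m n} → Vec (Vec (Fin m) n) d → Rows
rowsOfMatrix P = map rowList (toList P)

subst-natural : ∀ {I B : Set} (F : I → Set) (g : ∀ {i} → F i → B) {i j} (e : i ≡ j) (x : F i) → g (subst F e x) ≡ g x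
subst-natural F g refl x = refl

rowList-injective : ∀ {m n} (v w : Vec (Fin m) n) → rowList v ≡ rowList w → v ≡ w
rowList-injective [] [] _ = refl
rowList-injective (x ∷ v) (y ∷ w) e =
  cong₂ _∷_ (toℕ-injective (proj₁ (∷-injective e))) (rowList-injective v w (proj₂ (∷-injective e)))

rowsOfMatrix-injective : ∀ {d m n} (P Q : Vec (Vec (Fin m) n) d) → rowsOfMatrix P ≡ rowsOfMatrix Q → P ≡ Q
rowsOfMatrix-injective [] [] _ = refl
rowsOfMatrix-injective (v ∷ P) (w ∷ Q) e =
  cong₂ _∷_ (rowList-injective v w (proj₁ (∷-injective e))) (rowsOfMatrix-injective P Q (proj₂ (∷-injective e)))

rowOfList : ∀ {m} xs → All (_< m) xs → Vec (Fin m) (length xs)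
rowOfList [] [] = []
rowOfList (x ∷ xs) (x<m ∷ xs<m) = fromℕ< x<m ∷ rowOfList xs xs<m

rowList-rowOfList : ∀ {m} xs (xs<m : All (_< m) xs) → rowList (rowOfList xs xs<m) ≡ xs
rowList-rowOfList [] [] = refl
rowList-rowOfList (x ∷ xs) (x<m ∷ xs<m) = cong₂ _∷_ (toℕ-fromℕ< x<m) (rowList-rowOfList xs xs<m)

matrixOfRows : ∀ {m} rows → All (IsPerm m) rows → Matrix (length rows) m
matrixOfRows [] [] = []
matrixOfRows (xs ∷ rows) (p ∷ ps) = subst (Vec (Fin _)) (length≡ p) (rowOfList xs (bounded p)) ∷ matrixOfRows rows ps

rowsOfMatrix-matrixOfRows : ∀ {m} rows (ps : All (IsPerm m) rows) → rowsOfMatrix (matrixOfRows rows ps) ≡ rows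
rowsOfMatrix-matrixOfRows [] [] = refl
rowsOfMatrix-matrixOfRows (xs ∷ rows) (p ∷ ps) = cong₂ _∷_
  (trans (subst-natural (Vec (Fin _)) rowList (length≡ p) _) (rowList-rowOfList xs (bounded p)))
  (rowsOfMatrix-matrixOfRows rows ps)

rowList-tabulate : ∀ {n m} (f : Fin n → Fin m) (g : ℕ → ℕ) → (∀ i → toℕ (f i) ≡ g (toℕ i)) →
                   rowList (tabulate f) ≡ applyUpTo g n
rowList-tabulate {zero} f g f≗g = refl
rowList-tabulate {suc n} f g f≗g = cong₂ _∷_ (f≗g Fin.zero) (rowList-tabulate (f ∘ Fin.suc) (g ∘ suc) (f≗g ∘ Fin.suc))

rowList-allFin : ∀ m → rowList (allFin m) ≡ upTo m
rowList-allFin m = rowList-tabulate id id (λ _ → refl)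

rowList-perm : ∀ {m} (v : Vec (Fin m) m) → Unique (rowList v) → IsPerm m (rowList v)
rowList-perm v u = record
  { length≡ = trans (length-map toℕ (toList v)) (length-toList v)
  ; bounded = Allₚ.map⁺ (All.universal toℕ<n (toList v))
  ; unique = u
  }

not-≡ᵇ⁻ : ∀ {x y} → not (x ≡ᵇ y) ≡ true → x ≢ y
not-≡ᵇ⁻ {x} e refl = true≢false (trans (sym e) (cong not (Equivalence.to T-≡ (≡⇒≡ᵇ x x refl))))

not-≡ᵇ⁺ : ∀ {x y} → x ≢ y → not (x ≡ᵇ y) ≡ true
not-≡ᵇ⁺ {x} {y} x≢y with x ≡ᵇ y in e
... | true = contradiction (≡ᵇ⇒≡ x y (Equivalence.from T-≡ e)) x≢y
... | false = refl

distinct⁻ : ∀ xs → distinct xs ≡ true → Unique xs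
distinct⁻ [] _ = []
distinct⁻ (x ∷ xs) e = All.map not-≡ᵇ⁻ (all-true⁻ xs (∧-elimˡ e)) ∷ distinct⁻ xs (∧-elimʳ e)

distinct⁺ : ∀ {xs} → Unique xs → distinct xs ≡ true
distinct⁺ [] = refl
distinct⁺ (x∉xs ∷ u) = ∧-intro (all-true⁺ (All.map not-≡ᵇ⁺ x∉xs)) (distinct⁺ u)

Bool-irrelevant : ∀ {a b : Bool} (p q : a ≡ b) → p ≡ q
Bool-irrelevant = Decidable⇒UIP.≡-irrelevant Boolₚ._≟_

×-irrelevant : ∀ {A B : Set} → (∀ (p q : A) → p ≡ q) → (∀ (p q : B) → p ≡ q) → ∀ (p q : A × B) → p ≡ q
×-irrelevant irrA irrB (a , b) (a′ , b′) = cong₂ _,_ (irrA a a′) (irrB b b′)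

Σ-≡-irrelevant : ∀ {A : Set} {P : A → Set} → (∀ {x} (p q : P x) → p ≡ q) →
                 ∀ {x y} {p : P x} {q : P y} → x ≡ y → _≡_ {A = Σ A P} (x , p) (y , q)
Σ-≡-irrelevant irr {p = p} {q} refl = cong (_ ,_) (irr p q)

rightOk-node⁻ : ∀ {q} {c c′ : Fin q} {l r} → rightOk c (node c′ l r) ≡ true → c ≢ c′
rightOk-node⁻ {c = c} {c′} ok c≡c′ with c ≟ᶠ c′
... | yes _ = true≢false (sym ok)
... | no c≢c′ = c≢c′ c≡c′

node-cong : ∀ {q} {c c′ : Fin q} {l l′ r r′} → c ≡ c′ → l ≡ l′ → r ≡ r′ → node c l r ≡ node c′ l′ r′
node-cong refl refl refl = refl

size-node : ∀ {q} (l r : BTree q) → suc (size l) + suc (size r) ≡ suc (suc (size l + size r))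
size-node l r = cong suc (+-suc (size l) (size r))

size-node-∸ : ∀ {q} (l r : BTree q) → suc (suc (size l + size r)) ∸ suc (size l) ≡ suc (size r)
size-node-∸ l r = trans (cong (_∸ size l) (sym (+-suc (size l) (size r)))) (m+n∸m≡n (size l) (suc (size r)))

size-left<size-node : ∀ {q} (l r : BTree q) → suc (size l) < suc (suc (size l + size r))
size-left<size-node l r = s≤s (s≤s (m≤m+n (size l) (size r)))

-- The d-permutation of a guillotine partition, d = suc k

module _ (k : ℕ) where

  -- Colour c of a cut says in which direction each of the d rows is summed: always a direct
  -- sum in the first row (which stays the identity), and the bits of c in the other k rows.
  directions : Fin (2 ^ k) → List Bool
  directions c = true ∷ toList (bits k c)

  length-directions : ∀ c → length (directions c) ≡ suc k
  length-directions c = cong suc (length-toList (bits k c))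

  rowsOf : BTree (2 ^ k) → Rows
  rowsOf leaf = [ 0 ] ∷ replicate k [ 0 ]
  rowsOf (node c l r) = joinRows (directions c) (suc (size l)) (suc (size r)) (rowsOf l) (rowsOf r)

  Shape : ℕ → Rows → Set
  Shape m rows = Σ Rows λ rest → rows ≡ upTo m ∷ rest × length rest ≡ k

  rowsOf-shape : ∀ t → Shape (suc (size t)) (rowsOf t)
  rowsOf-shape leaf = replicate k [ 0 ] , refl , length-replicate k
  rowsOf-shape (node c l r) with rowsOf-shape l | rowsOf-shape r
  ... | restˡ , eˡ , lengthˡ | restʳ , eʳ , lengthʳ = joinRows cbits a b restˡ restʳ , head≡ , length-rest
    where
    a = suc (size l)
    b = suc (size r)
    cbits = toList (bits k c)
    head≡ : rowsOf (node c l r) ≡ upTo (suc (size (node c l r))) ∷ joinRows cbits a b restˡ restʳ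
    head≡ rewrite eˡ | eʳ = cong (_∷ joinRows cbits a b restˡ restʳ) (trans (sym (upTo-+ a b)) (cong upTo (size-node l r)))
    length-rest : length (joinRows cbits a b restˡ restʳ) ≡ k
    length-rest = trans (length-joinRows cbits restˡ restʳ (trans lengthˡ (sym (length-toList (bits k c))))
                                                           (trans lengthʳ (sym (length-toList (bits k c)))))
                        (length-toList (bits k c))

  length-rowsOf : ∀ t → length (rowsOf t) ≡ suc k
  length-rowsOf t with rowsOf-shape t
  ... | rest , e , length-rest = trans (cong length e) (cong suc length-rest)

  rowsOf-perm : ∀ t → All (IsPerm (suc (size t))) (rowsOf t)
  rowsOf-perm leaf = upTo-perm 1 ∷ Allₚ.replicate⁺ k (upTo-perm 1)
  rowsOf-perm (node c l r) = subst (λ m → All (IsPerm m) (rowsOf (node c l r))) (size-node l r)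
                                   (joinRows-perm (directions c) (rowsOf-perm l) (rowsOf-perm r))

  private
    length-rowsOf-aligned : ∀ c t → length (rowsOf t) ≡ length (directions c)
    length-rowsOf-aligned c t = trans (length-rowsOf t) (sym (length-directions c))

  leftParts-rowsOf : ∀ c l r → leftParts (suc (size l)) (rowsOf (node c l r)) ≡ rowsOf l
  leftParts-rowsOf c l r = leftParts-joinRows (directions c) (rowsOf-perm l) (rowsOf-perm r)
                             (length-rowsOf-aligned c l) (length-rowsOf-aligned c r)

  rightParts-rowsOf : ∀ c l r → rightParts (suc (size l)) (rowsOf (node c l r)) ≡ rowsOf r
  rightParts-rowsOf c l r = rightParts-joinRows (directions c) (rowsOf-perm l) (rowsOf-perm r)
                              (length-rowsOf-aligned c l) (length-rowsOf-aligned c r)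

  rowsOf-isSplit : ∀ c l r f → sepAux f (suc (size l)) (rowsOf l) ≡ true → sepAux f (suc (size r)) (rowsOf r) ≡ true →
                   IsSplit f (suc (size (node c l r))) (rowsOf (node c l r)) (suc (size l))
  rowsOf-isSplit c l r f sepˡ sepʳ = isSplit z<s (splitsAt-joinRows (directions c) (rowsOf-perm l) (rowsOf-perm r))
    (subst (λ rows → sepAux f (suc (size l)) rows ≡ true) (sym (leftParts-rowsOf c l r)) sepˡ)
    (subst₂ (λ m rows → sepAux f m rows ≡ true) (sym (size-node-∸ l r)) (sym (rightParts-rowsOf c l r)) sepʳ)

  rowsOf-separable : ∀ t f → suc (size t) ≤ f → sepAux f (suc (size t)) (rowsOf t) ≡ true
  rowsOf-separable leaf (suc f) _ = refl
  rowsOf-separable (node c l r) (suc f) (s≤s size≤f) =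
    sepAux⁺ f _ _ _ (size-left<size-node l r) (rowsOf-isSplit c l r f
      (rowsOf-separable l f (≤-trans (s≤s (m≤m+n (size l) (size r))) size≤f))
      (rowsOf-separable r f (≤-trans (s≤s (m≤n+m (size r) (size l))) size≤f)))

  -- A valid tree has no split of its rows strictly inside the right subtree: by
  -- joinRows-inner-directions it would force the right child to have the colour of the root.
  rowsOf-no-inner-split : ∀ c l r → validTree (node c l r) ≡ true → ∀ j → suc (size l) < j → j < suc (size (node c l r)) →
                          all (splitsAt j) (rowsOf (node c l r)) ≡ false
  rowsOf-no-inner-split c l leaf _ j a<j j<m =
    contradiction (subst (λ n → suc (suc n) ≤ j) (sym (+-identityʳ (size l))) a<j) (<⇒≱ j<m)
  rowsOf-no-inner-split c l r@(node c′ rl rr) valid j a<j j<m with all (splitsAt j) (rowsOf (node c l r)) in split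
  ... | false = refl
  ... | true = contradiction (toList-bits-injective (∷-injectiveʳ same-directions)) (rightOk-node⁻ {l = rl} {rr} (∧-elimˡ valid))
    where
    same-directions : directions c ≡ directions c′
    same-directions = joinRows-inner-directions (directions c) (directions c′) z<s z<s z<s a<j
      (subst (j <_) (sym (size-node l r)) j<m) (rowsOf-perm l) (rowsOf-perm r) (rowsOf-perm rl) (rowsOf-perm rr)
      (length-rowsOf-aligned c l) (length-rowsOf-aligned c rl) (length-rowsOf-aligned c rr)
      (trans (length-directions c′) (sym (length-directions c))) split

  -- Decomposing rows into a tree

  colourOf : ℕ → Rows → Fin (2 ^ k)
  colourOf ℓ rows = fromBits (toVec k (map (ascendsᵇ ℓ) (drop 1 rows)))

  colourOf-rowsOf : ∀ c l r → colourOf (suc (size l)) (rowsOf (node c l r)) ≡ c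
  colourOf-rowsOf c l r = begin
    fromBits (toVec k (map (ascendsᵇ a) (drop 1 rows)))  ≡⟨ cong (fromBits ∘ toVec k) (drop-map 1 rows) ⟨
    fromBits (toVec k (drop 1 (map (ascendsᵇ a) rows)))  ≡⟨ cong (fromBits ∘ toVec k ∘ drop 1) ascends≡directions ⟩
    fromBits (toVec k (toList (bits k c)))               ≡⟨ cong fromBits (toVec-toList (bits k c)) ⟩
    fromBits (bits k c)                                  ≡⟨ fromBits-bits {k} c ⟩
    c                                                    ∎
    where
    open ≡-Reasoning
    a = suc (size l)
    rows = rowsOf (node c l r)
    ascends≡directions : map (ascendsᵇ a) rows ≡ directions c
    ascends≡directions = ascendsᵇ-joinRows z<s z<s (directions c) (rowsOf-perm l) (rowsOf-perm r)
                           (length-rowsOf-aligned c l) (length-rowsOf-aligned c r)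

  -- Cuts at the last split position ℓ, i.e. the highest hyperplane; f is fuel.
  decompose : ℕ → ℕ → Rows → BTree (2 ^ k)
  decompose zero m rows = leaf
  decompose (suc f) m rows with findLast (splitTest f m rows) m
  ... | nothing = leaf
  ... | just ℓ = node (colourOf ℓ rows) (decompose f ℓ (leftParts ℓ rows)) (decompose f (m ∸ ℓ) (rightParts ℓ rows))

  decompose-just : ∀ f m rows {ℓ} → findLast (splitTest f m rows) m ≡ just ℓ →
                   decompose (suc f) m rows
                     ≡ node (colourOf ℓ rows) (decompose f ℓ (leftParts ℓ rows)) (decompose f (m ∸ ℓ) (rightParts ℓ rows))
  decompose-just f m rows last rewrite last = refl

  decompose-rowsOf : ∀ t → validTree t ≡ true → ∀ f → suc (size t) ≤ f → decompose f (suc (size t)) (rowsOf t) ≡ t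
  decompose-rowsOf leaf _ (suc f) _ = refl
  decompose-rowsOf (node c l r) valid (suc f) (s≤s size≤f) =
    trans (decompose-just f m rows (findLast-last (splitTest f m rows) m a (root-test , size-left<size-node l r , no-later-test)))
    (node-cong (colourOf-rowsOf c l r)
      (trans (cong (decompose f a) (leftParts-rowsOf c l r))
             (decompose-rowsOf l validˡ f (≤-trans (s≤s (m≤m+n (size l) (size r))) size≤f)))
      (trans (cong₂ (decompose f) (size-node-∸ l r) (rightParts-rowsOf c l r))
             (decompose-rowsOf r validʳ f (≤-trans (s≤s (m≤n+m (size r) (size l))) size≤f))))
    where
    m = suc (size (node c l r))
    a = suc (size l)
    rows = rowsOf (node c l r)
    validˡ = ∧-elimˡ (∧-elimʳ {rightOk c r} valid)
    validʳ = ∧-elimʳ {validTree l} (∧-elimʳ {rightOk c r} valid)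
    root-test : splitTest f m rows a ≡ true
    root-test = splitTest⁺ (rowsOf-isSplit c l r f
      (rowsOf-separable l f (≤-trans (s≤s (m≤m+n (size l) (size r))) size≤f))
      (rowsOf-separable r f (≤-trans (s≤s (m≤n+m (size r) (size l))) size≤f)))
    no-later-test : ∀ j → a < j → j < m → splitTest f m rows j ≡ false
    no-later-test j a<j j<m rewrite <⇒<ᵇ-true {0} {j} (<-trans z<s a<j) | rowsOf-no-inner-split c l r valid j a<j j<m = refl

  directions-colourOf : ∀ ℓ {m rows} → Shape m rows → directions (colourOf ℓ rows) ≡ map (ascendsᵇ ℓ) rows
  directions-colourOf ℓ {m} (rest , refl , length-rest) =
    cong₂ _∷_ (sym (ascendsᵇ⁺ ℓ (upTo m) (upTo-ascends ℓ m)))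
      (trans (cong toList (bits-fromBits (toVec k (map (ascendsᵇ ℓ) rest))))
             (toList-toVec k _ (trans (length-map _ rest) length-rest)))

  shape-leftParts : ∀ {ℓ m rows} → ℓ ≤ m → Shape m rows → Shape ℓ (leftParts ℓ rows)
  shape-leftParts {ℓ} ℓ≤m (rest , refl , length-rest) =
    leftParts ℓ rest , cong (_∷ leftParts ℓ rest) (trans (cong relabel (take-upTo ℓ≤m)) (relabel-upTo ℓ)) ,
    trans (length-map _ rest) length-rest

  shape-rightParts : ∀ {ℓ m rows} → Shape m rows → Shape (m ∸ ℓ) (rightParts ℓ rows)
  shape-rightParts {ℓ} {m} (rest , refl , length-rest) =
    rightParts ℓ rest , cong (_∷ rightParts ℓ rest) (relabel-drop-upTo ℓ m) , trans (length-map _ rest) length-rest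

  size-decompose : ∀ f m rows → sepAux f m rows ≡ true → suc (size (decompose f m rows)) ≡ m
  size-decompose (suc f) m rows sep with findLast (splitTest f m rows) m in last
  ... | nothing = sym (lastSplit-nothing f m rows sep last)
  ... | just ℓ with ℓ<m , isSplit _ _ sepˡ sepʳ ← lastSplit-just f m rows last = begin
    suc (suc (size L + size R))      ≡⟨ cong suc (+-suc (size L) (size R)) ⟨
    suc (size L) + suc (size R)      ≡⟨ cong₂ _+_ (size-decompose f ℓ _ sepˡ) (size-decompose f (m ∸ ℓ) _ sepʳ) ⟩
    ℓ + (m ∸ ℓ)                      ≡⟨ m+[n∸m]≡n (<⇒≤ ℓ<m) ⟩
    m                                ∎
    where
    open ≡-Reasoning
    L = decompose f ℓ (leftParts ℓ rows)
    R = decompose f (m ∸ ℓ) (rightParts ℓ rows)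

  rowsOf-decompose : ∀ f m rows → Shape m rows → All (Standard m) rows → sepAux f m rows ≡ true →
                     rowsOf (decompose f m rows) ≡ rows
  rowsOf-decompose (suc f) m rows shape std sep with findLast (splitTest f m rows) m in last
  ... | nothing = leaf-rows (lastSplit-nothing f m rows sep last) shape std
    where
    leaf-rows : ∀ {m rows} → m ≡ 1 → Shape m rows → All (Standard m) rows → [ 0 ] ∷ replicate k [ 0 ] ≡ rows
    leaf-rows refl (rest , refl , length-rest) (_ ∷ std) = cong ([ 0 ] ∷_) (replicate-standard k rest length-rest std)
  ... | just ℓ with ℓ<m , isSplit _ splits sepˡ sepʳ ← lastSplit-just f m rows last =
    trans (joinRows-cong (directions-colourOf ℓ shape) (size-decompose f ℓ _ sepˡ) (size-decompose f (m ∸ ℓ) _ sepʳ)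
             (rowsOf-decompose f ℓ _ (shape-leftParts (<⇒≤ ℓ<m) shape) (standard-leftParts rows (<⇒≤ ℓ<m) std) sepˡ)
             (rowsOf-decompose f (m ∸ ℓ) _ (shape-rightParts {ℓ} shape) (standard-rightParts {ℓ} rows std) sepʳ))
          (joinRows-split rows (<⇒≤ ℓ<m) std splits)

  -- Equal colours at the last split ℓ and at the last split ℓʳ of the right part would make ℓ + ℓʳ a later split.
  last-splits-colours-differ :
    ∀ f m rows ℓ ℓʳ → m ≤ suc (suc f) → Shape m rows →
    findLast (splitTest (suc f) m rows) m ≡ just ℓ →
    findLast (splitTest f (m ∸ ℓ) (rightParts ℓ rows)) (m ∸ ℓ) ≡ just ℓʳ →
    colourOf ℓ rows ≢ colourOf ℓʳ (rightParts ℓ rows)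
  last-splits-colours-differ f m rows ℓ ℓʳ m≤2+f shape last lastʳ same-colour
    with test , ℓ<m , later-fails ← findLast-just _ m last
       | ℓʳ<m∸ℓ , splitʳ ← lastSplit-just f (m ∸ ℓ) (rightParts ℓ rows) lastʳ =
    true≢false (trans (sym (splitTest⁺ (isSplit-+ f m rows ℓ ℓʳ ℓ+ℓʳ<m ℓ≤f (splitTest⁻ test) splitʳ same-directions)))
                      (later-fails (ℓ + ℓʳ) (m<m+n ℓ 0<ℓʳ) ℓ+ℓʳ<m))
    where
    0<ℓʳ = IsSplit.positive splitʳ
    ℓ+ℓʳ<m : ℓ + ℓʳ < m
    ℓ+ℓʳ<m = subst (ℓ + ℓʳ <_) (m+[n∸m]≡n (<⇒≤ ℓ<m)) (+-monoʳ-< ℓ ℓʳ<m∸ℓ)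
    ℓ≤f : ℓ ≤ f
    ℓ≤f = ≤-pred (<-≤-trans (m<m+n ℓ 0<ℓʳ) (≤-pred (<-≤-trans ℓ+ℓʳ<m m≤2+f)))
    same-directions : map (ascendsᵇ ℓ) rows ≡ map (ascendsᵇ ℓʳ) (rightParts ℓ rows)
    same-directions = trans (sym (directions-colourOf ℓ shape))
                            (trans (cong directions same-colour) (directions-colourOf ℓʳ (shape-rightParts {ℓ} shape)))

  decompose-rightOk : ∀ f m rows ℓ → m ≤ suc f → Shape m rows → findLast (splitTest f m rows) m ≡ just ℓ →
                      rightOk (colourOf ℓ rows) (decompose f (m ∸ ℓ) (rightParts ℓ rows)) ≡ true
  decompose-rightOk zero m rows ℓ _ _ _ = refl
  decompose-rightOk (suc f) m rows ℓ m≤2+f shape last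
    with findLast (splitTest f (m ∸ ℓ) (rightParts ℓ rows)) (m ∸ ℓ) in lastʳ
  ... | nothing = refl
  ... | just ℓʳ with colourOf ℓ rows ≟ᶠ colourOf ℓʳ (rightParts ℓ rows)
  ...   | no _ = refl
  ...   | yes same-colour = ⊥-elim (last-splits-colours-differ f m rows ℓ ℓʳ m≤2+f shape last lastʳ same-colour)

  decompose-valid : ∀ f m rows → m ≤ f → Shape m rows → sepAux f m rows ≡ true → validTree (decompose f m rows) ≡ true
  decompose-valid (suc f) m rows m≤1+f shape sep with findLast (splitTest f m rows) m in last
  ... | nothing = refl
  ... | just ℓ with ℓ<m , isSplit 0<ℓ _ sepˡ sepʳ ← lastSplit-just f m rows last =
    ∧-intro (decompose-rightOk f m rows ℓ m≤1+f shape last)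
      (∧-intro (decompose-valid f ℓ _ (≤-pred (<-≤-trans ℓ<m m≤1+f)) (shape-leftParts (<⇒≤ ℓ<m) shape) sepˡ)
               (decompose-valid f (m ∸ ℓ) _ (≤-pred (<-≤-trans (∸-monoʳ-< 0<ℓ (<⇒≤ ℓ<m)) m≤1+f))
                  (shape-rightParts {ℓ} shape) sepʳ))

  isDPerm⁻-shape : ∀ {m} (P : Matrix (suc k) m) → isDPerm P ≡ true → Shape m (rowsOfMatrix P)
  isDPerm⁻-shape {m} (v ∷ P) e = rowsOfMatrix P ,
    cong (_∷ rowsOfMatrix P) (trans (cong rowList (toWitness {a? = ≡-dec _≟ᶠ_ v (allFin m)} (Equivalence.from T-≡ (∧-elimˡ e))))
                                    (rowList-allFin m)) ,
    trans (length-map rowList (toList P)) (length-toList P)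

  isDPerm⁻-unique : ∀ {m} (P : Matrix (suc k) m) → isDPerm P ≡ true → All Unique (rowsOfMatrix P)
  isDPerm⁻-unique {m} (v ∷ P) e =
    distinct⁻ _ (∧-elimˡ e′) ∷ Allₚ.map⁺ (All.map (distinct⁻ _) (Allₚ.map⁻ (all-true⁻ _ (∧-elimʳ e′))))
    where e′ = ∧-elimʳ {⌊ ≡-dec _≟ᶠ_ v (allFin m) ⌋} e

  isDPerm⁻-standard : ∀ {m} (P : Matrix (suc k) m) → isDPerm P ≡ true → All (Standard m) (rowsOfMatrix P)
  isDPerm⁻-standard {m} P e = Allₚ.map⁺ (All.zipWith (λ {v} (u , _) → standard (rowList-perm v u))
                                          (Allₚ.map⁻ (isDPerm⁻-unique P e) , All.universal (λ _ → tt) (toList P)))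
    where
    standard : ∀ {xs} → IsPerm m xs → Standard m xs
    standard p = length≡ p , relabel-perm p

  isDPerm⁺ : ∀ {m} (P : Matrix (suc k) m) → Shape m (rowsOfMatrix P) → All Unique (rowsOfMatrix P) → isDPerm P ≡ true
  isDPerm⁺ {m} (v ∷ P) (_ , e , _) (u ∷ us) = ∧-intro
    (Equivalence.to T-≡ (fromWitness {a? = ≡-dec _≟ᶠ_ v (allFin m)}
      (rowList-injective v (allFin m) (trans (proj₁ (∷-injective e)) (sym (rowList-allFin m))))))
    (∧-intro (distinct⁺ u) (all-true⁺ (Allₚ.map⁺ (All.map distinct⁺ (Allₚ.map⁻ us)))))

  matrixOf : ∀ t → Matrix (suc k) (suc (size t))
  matrixOf t = subst (λ d → Matrix d (suc (size t))) (length-rowsOf t) (matrixOfRows (rowsOf t) (rowsOf-perm t))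

  rowsOfMatrix-matrixOf : ∀ t → rowsOfMatrix (matrixOf t) ≡ rowsOf t
  rowsOfMatrix-matrixOf t = trans (subst-natural (λ d → Matrix d _) rowsOfMatrix (length-rowsOf t) _)
                                  (rowsOfMatrix-matrixOfRows (rowsOf t) (rowsOf-perm t))

  matrixOf-dPerm : ∀ t → isDPerm (matrixOf t) ≡ true
  matrixOf-dPerm t =
    isDPerm⁺ (matrixOf t) (subst (Shape (suc (size t))) (sym (rowsOfMatrix-matrixOf t)) (rowsOf-shape t))
             (subst (All Unique) (sym (rowsOfMatrix-matrixOf t)) (All.map unique (rowsOf-perm t)))

  matrixOf-separable : ∀ t → separable (matrixOf t) ≡ true
  matrixOf-separable t = subst (λ rows → sepAux (suc (size t)) (suc (size t)) rows ≡ true) (sym (rowsOfMatrix-matrixOf t))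
                               (rowsOf-separable t (suc (size t)) ≤-refl)

  toSeparable : ∀ {n} → Guillotine (2 ^ k) n → SeparableDPerm (suc k) (suc n)
  toSeparable (t , refl , _) = matrixOf t , matrixOf-dPerm t , matrixOf-separable t

  rowsOfMatrix-toSeparable : ∀ {n} (x : Guillotine (2 ^ k) n) → rowsOfMatrix (proj₁ (toSeparable x)) ≡ rowsOf (proj₁ x)
  rowsOfMatrix-toSeparable (t , refl , _) = rowsOfMatrix-matrixOf t

  fromSeparable : ∀ {n} → SeparableDPerm (suc k) (suc n) → Guillotine (2 ^ k) n
  fromSeparable {n} (P , dPerm , sep) = decompose (suc n) (suc n) (rowsOfMatrix P) ,
    suc-injective (size-decompose (suc n) (suc n) _ sep) ,
    decompose-valid (suc n) (suc n) _ ≤-refl (isDPerm⁻-shape P dPerm) sep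

  fromSeparable-toSeparable : ∀ {n} (x : Guillotine (2 ^ k) n) → fromSeparable (toSeparable x) ≡ x
  fromSeparable-toSeparable (t , refl , valid) = Σ-≡-irrelevant (×-irrelevant ≡-irrelevant Bool-irrelevant) (begin
    decompose (suc (size t)) (suc (size t)) (rowsOfMatrix (matrixOf t))  ≡⟨ cong (decompose _ _) (rowsOfMatrix-matrixOf t) ⟩
    decompose (suc (size t)) (suc (size t)) (rowsOf t)                   ≡⟨ decompose-rowsOf t valid (suc (size t)) ≤-refl ⟩
    t                                                                    ∎)
    where open ≡-Reasoning

  toSeparable-fromSeparable : ∀ {n} (y : SeparableDPerm (suc k) (suc n)) → toSeparable (fromSeparable y) ≡ y
  toSeparable-fromSeparable {n} y@(P , dPerm , sep) = Σ-≡-irrelevant (×-irrelevant Bool-irrelevant Bool-irrelevant)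
    (rowsOfMatrix-injective _ P (begin
      rowsOfMatrix (proj₁ (toSeparable (fromSeparable y)))  ≡⟨ rowsOfMatrix-toSeparable (fromSeparable y) ⟩
      rowsOf (decompose (suc n) (suc n) (rowsOfMatrix P))   ≡⟨ rowsOf-decompose (suc n) (suc n) _ (isDPerm⁻-shape P dPerm)
                                                                  (isDPerm⁻-standard P dPerm) sep ⟩
      rowsOfMatrix P                                        ∎))
    where open ≡-Reasoning

  guillotine⤖separable : ∀ n → Guillotine (2 ^ k) n ⤖ SeparableDPerm (suc k) (suc n)
  guillotine⤖separable n = ↔⇒⤖ (mk↔ₛ′ toSeparable fromSeparable toSeparable-fromSeparable fromSeparable-toSeparable)

mainTheorem4 : (d n : ℕ) → 1 ≤ d → Guillotine (2 ^ (d ∸ 1)) n ⤖ SeparableDPerm d (suc n)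
mainTheorem4 (suc k) n _ = guillotine⤖separable k n
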